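{- Let $n\ge1$. The set $\{g(\cdot):g\in G\}$ equals the group $\langle\rho(\cdot),\omega(\cdot)\rangle$ generated under composition by the maps $\rho(\cdot)$ and $\omega(\cdot)$, and it is a subgroup of the symmetric group on $\mathcal{D}_n$; moreover $(\rho(\cdot))^{2n}=(\omega(\cdot))^2=\mathrm{id}$ and $\rho(\cdot)\circ\omega(\cdot)\circ\rho(\cdot)=\omega(\cdot)$.
   Context: A Dyck path of size $n$ is a word in $\mathtt{u},\mathtt{d}$ with $n$ of each letter whose every prefix has at least as many $\mathtt{u}$'s as $\mathtt{d}$'s; $\mathcal{D}_n$ is their set. The tunneling $\tau_D\in S_{2n}$ of $D$ is the fixed-point-free involution pairing each up-step position with the position of its matching down-step. For $\sigma\in S_{2n}$, $\sigma_k=\sigma(k)$, $\sigma_{[k]}=\{\sigma_1,\dots,\sigma_k\}$; $\sigma(D)$ is the word with $\sigma(D)_k=\mathtt{u}$ if $\tau_D(\sigma_k)\notin\sigma_{[k]}$ and $\mathtt{d}$ otherwise, and $\sigma(\cdot)$ is the map $D\mapsto\sigma(D)$ on $\mathcal{D}_n$. The permutations $\rho,\omega\in S_{2n}$ are $\rho(k)=k+1$ and $\omega(k)=2n-k$ (arithmetic modulo $2n$, values in $[2n]$), and $G=\langle\rho,\omega\rangle\le S_{2n}$. -}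

module Defs where

open import Data.Nat using (ℕ; zero; suc; _+_; _*_; _∸_; _≤_; _<ᵇ_; _≡ᵇ_)
open import Data.Bool using (Bool; true; false; if_then_else_; _∧_)
open import Data.List using (List; []; _∷_; length; take; drop; filter; map; reverse)
open import Data.Bool.ListAction using (any)
open import Data.Product using (_×_)
open import Relation.Binary.PropositionalEquality using (_≡_)
open import Relation.Nullary using (¬_)
open import Function using (id; _∘_)

data Step : Set where
  u d : Step

isU : Step → Bool
isU u = true
isU d = false

isD : Step → Bool
isD u = false
isD d = true

Word : Set
Word = List Step

#u : Word → ℕ → ℕ
#u D k = length (filter (λ s → isU s Data.Bool.≟ true) (take k D))
  where import Data.Bool
#d : Word → ℕ → ℕ
#d D k = length (filter (λ s → isD s Data.Bool.≟ true) (take k D))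
  where import Data.Bool

IsDyck : ℕ → Word → Set
IsDyck n D = length D ≡ 2 * n
           × #u D (2 * n) ≡ n
           × #d D (2 * n) ≡ n
           × (∀ k → k ≤ 2 * n → #d D k ≤ #u D k)

-- 1-indexed letter lookup (default u outside the range; never used there)
letter : Word → ℕ → Step
letter D k with drop (k ∸ 1) D
... | []    = u
... | s ∷ _ = s

range : ℕ → ℕ → List ℕ
range a b = go a (suc b ∸ a)
  where
  go : ℕ → ℕ → List ℕ
  go x zero    = []
  go x (suc r) = x ∷ go (suc x) r

-- first element of a list satisfying p (0 if none)
first : (ℕ → Bool) → List ℕ → ℕ
first p []       = 0
first p (x ∷ xs) = if p x then x else first p xs

-- equal height after the first i and after the first j letters
sameHeight : Word → ℕ → ℕ → Bool
sameHeight D i j = (#u D i + #d D j) ≡ᵇ (#d D i + #u D j)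

-- Tunneling τ_D (1-indexed positions in [2n], 2n = length D):
-- an up-step at p is matched with the first q > p at which the path
-- returns to the height it had before p; a down-step at p is matched with
-- the last q < p whose starting height equals the height after p.
tunnel : Word → ℕ → ℕ
tunnel D p with letter D p
... | u = first (λ q → sameHeight D q (p ∸ 1)) (range (suc p) (length D))
... | d = first (λ q → sameHeight D (q ∸ 1) p) (reverse (range 1 (p ∸ 1)))

-- σ(D) for σ : [2n] → [2n] (given as a function on ℕ; only values on [2n] matter):
-- σ(D)_k = u iff τ_D(σ_k) ∉ {σ_1, …, σ_k}.
act : ℕ → (ℕ → ℕ) → Word → Word
act n σ D = map letterAt (range 1 (2 * n))
  where
  letterAt : ℕ → Step
  letterAt k = if any (λ j → tunnel D (σ k) ≡ᵇ σ j) (range 1 k) then d else u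

-- ρ(k) = k+1 and ω(k) = 2n - k modulo 2n, values in [2n]  (1-indexed)
ρ : ℕ → ℕ → ℕ
ρ n k = if k <ᵇ 2 * n then suc k else 1

ω : ℕ → ℕ → ℕ
ω n k = if k <ᵇ 2 * n then 2 * n ∸ k else 2 * n

ρ⁻¹ : ℕ → ℕ → ℕ
ρ⁻¹ n k = if k <ᵇ 2 then 2 * n else k ∸ 1

-- G = ⟨ρ, ω⟩ ≤ S_{2n}: all finite products of the generators and their
-- inverses (ω is an involution, ω⁻¹ = ω).
data InG (n : ℕ) : (ℕ → ℕ) → Set where
  G-id  : InG n id
  G-ρ   : InG n (ρ n)
  G-ρ⁻¹ : InG n (ρ⁻¹ n)
  G-ω   : InG n (ω n)
  G-∘   : ∀ {f g} → InG n f → InG n g → InG n (f ∘ g)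

data InM (n : ℕ) : (Word → Word) → Set where
  M-id : InM n id
  M-ρ  : InM n (act n (ρ n))
  M-ω  : InM n (act n (ω n))
  M-∘  : ∀ {f g} → InM n f → InM n g → InM n (f ∘ g)

_≈[_]_ : (Word → Word) → ℕ → (Word → Word) → Set
f ≈[ n ] g = ∀ D → IsDyck n D → f D ≡ g D

_^^_ : (Word → Word) → ℕ → (Word → Word)
f ^^ zero  = id
f ^^ suc k = f ∘ (f ^^ k)

-- The tunneling τ_D of a Dyck path D is a noncrossing perfect matching of [2n], and D has its
-- up-steps exactly at the openers of τ_D; conversely, the word with up-steps at the openers of
-- a noncrossing matching is a Dyck path whose tunneling is that matching (heights over an arc
-- stay above its starting height and come back to it at the closer). By definition σ(D)_k = d
-- iff σ⁻¹(τ_D(σ_k)) < k, so σ(D) is the Dyck path of σ⁻¹ ∘ τ_D ∘ σ whenever conjugation by σ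
-- preserves noncrossing matchings. Rotations and reflections of the 2n-gon do, hence so does
-- every g ∈ G, and then (σ ∘ π)(D) = π(σ(D)): g ↦ g(·) is an anti-homomorphism on G, which
-- turns the relations of G into those of the maps on D_n.
module Submission where

open import Defs
open import Data.Nat using (ℕ; zero; suc; _+_; _*_; _∸_; _≤_; _<_; z≤n; s≤s; _<ᵇ_; _≡ᵇ_; _≤?_; _<?_)
open import Data.Nat.Properties
open import Data.Nat.Induction using (<-wellFounded)
open import Induction.WellFounded using (Acc; acc)
open import Data.Bool using (Bool; true; false; if_then_else_; _∨_)
open import Data.Bool.Properties using (T-≡; ¬-not; ⇔→≡)
open import Data.List using (List; []; _∷_; length; map; reverse; _++_)
open import Data.List.Properties using (take-all; reverse-++; length-map)
open import Data.Bool.ListAction using (any)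
open import Data.Product using (Σ; _×_; _,_; proj₁; proj₂)
open import Data.Sum using (_⊎_; inj₁; inj₂)
open import Data.Empty using (⊥; ⊥-elim)
open import Relation.Binary.PropositionalEquality
open import Relation.Binary.Definitions using (tri<; tri≈; tri>)
open import Relation.Nullary using (yes; no)
open import Function using (id; _∘_; _⇔_; mk⇔; Equivalence)
import Data.Integer as ℤ
import Data.Integer.Properties as ℤ
open import Data.Integer.Tactic.RingSolver using (solve-∀)

u≢d : u ≢ d
u≢d ()

i<suc[i] : ∀ i → i ℤ.< ℤ.suc i
i<suc[i] i = ℤ.suc[i]≤j⇒i<j ℤ.≤-refl

pred[i]<i : ∀ i → ℤ.pred i ℤ.< i
pred[i]<i i = ℤ.i≤pred[j]⇒i<j ℤ.≤-refl

≡ᵇ-true : ∀ {x y} → x ≡ y → (x ≡ᵇ y) ≡ true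
≡ᵇ-true {x} {y} x≡y = Equivalence.to T-≡ (≡⇒≡ᵇ x y x≡y)

≡ᵇ-false : ∀ {x y} → x ≢ y → (x ≡ᵇ y) ≡ false
≡ᵇ-false {x} {y} x≢y = ¬-not (x≢y ∘ ≡ᵇ⇒≡ x y ∘ Equivalence.from T-≡)

≡ᵇ-cong : ∀ {a b c e} → a ≡ b ⇔ c ≡ e → (a ≡ᵇ b) ≡ (c ≡ᵇ e)
≡ᵇ-cong {a} {b} {c} {e} a≡b⇔c≡e = ⇔→≡ {z = true} (mk⇔
  (≡ᵇ-true ∘ Equivalence.to a≡b⇔c≡e ∘ ≡ᵇ⇒≡ a b ∘ Equivalence.from T-≡)
  (≡ᵇ-true ∘ Equivalence.from a≡b⇔c≡e ∘ ≡ᵇ⇒≡ c e ∘ Equivalence.from T-≡))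

<ᵇ-true : ∀ {m n} → m < n → (m <ᵇ n) ≡ true
<ᵇ-true m<n = Equivalence.to T-≡ (<⇒<ᵇ m<n)

<ᵇ-false : ∀ {m n} → n ≤ m → (m <ᵇ n) ≡ false
<ᵇ-false {m} {n} n≤m = ¬-not (λ m<ᵇn → <⇒≱ (<ᵇ⇒< m n (Equivalence.from T-≡ m<ᵇn)) n≤m)

data CountStep (W : Word) (k : ℕ) : Set where
  u-step : letter W (suc k) ≡ u → #u W (suc k) ≡ suc (#u W k) → #d W (suc k) ≡ #d W k → CountStep W k
  d-step : letter W (suc k) ≡ d → #u W (suc k) ≡ #u W k → #d W (suc k) ≡ suc (#d W k) → CountStep W k

count-step : ∀ W k → k < length W → CountStep W k
count-step (u ∷ W) zero    _       = u-step refl refl refl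
count-step (d ∷ W) zero    _       = d-step refl refl refl
count-step (u ∷ W) (suc k) (s≤s k<) with count-step W k k<
... | u-step l cu cd = u-step l (cong suc cu) cd
... | d-step l cu cd = d-step l (cong suc cu) cd
count-step (d ∷ W) (suc k) (s≤s k<) with count-step W k k<
... | u-step l cu cd = u-step l cu (cong suc cd)
... | d-step l cu cd = d-step l cu (cong suc cd)

#u+#d≡k : ∀ W k → k ≤ length W → #u W k + #d W k ≡ k
#u+#d≡k W zero    _  = refl
#u+#d≡k W (suc k) k< with count-step W k k<
... | u-step _ cu cd rewrite cu | cd = cong suc (#u+#d≡k W k (<⇒≤ k<))
... | d-step _ cu cd rewrite cu | cd = trans (+-suc (#u W k) (#d W k)) (cong suc (#u+#d≡k W k (<⇒≤ k<)))

height : Word → ℕ → ℤ.ℤ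
height W k = ℤ.+ #u W k ℤ.- ℤ.+ #d W k

data HeightStep (W : Word) (k : ℕ) : Set where
  rise : letter W (suc k) ≡ u → height W (suc k) ≡ ℤ.suc (height W k) → HeightStep W k
  fall : letter W (suc k) ≡ d → height W (suc k) ≡ ℤ.pred (height W k) → HeightStep W k

height-step : ∀ W k → k < length W → HeightStep W k
height-step W k k< with count-step W k k<
... | u-step l cu cd = rise l (begin
      ℤ.+ #u W (suc k) ℤ.- ℤ.+ #d W (suc k)  ≡⟨ cong₂ (λ a b → ℤ.+ a ℤ.- ℤ.+ b) cu cd ⟩
      ℤ.+ suc (#u W k) ℤ.- ℤ.+ #d W k         ≡⟨ ℤ.suc-+ (#u W k) (ℤ.- ℤ.+ #d W k) ⟩
      ℤ.suc (height W k)                      ∎)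
  where open ≡-Reasoning
... | d-step l cu cd = fall l (begin
      ℤ.+ #u W (suc k) ℤ.- ℤ.+ #d W (suc k)  ≡⟨ cong₂ (λ a b → ℤ.+ a ℤ.- ℤ.+ b) cu cd ⟩
      ℤ.+ #u W k ℤ.- ℤ.+ suc (#d W k)         ≡⟨ ℤ.minus-suc (ℤ.+ #u W k) (#d W k) ⟩
      ℤ.pred (height W k)                     ∎)
  where open ≡-Reasoning

height-stalls : ∀ W k → length W ≤ k → height W (suc k) ≡ height W k
height-stalls W k len≤k
  rewrite take-all (suc k) W (m≤n⇒m≤1+n len≤k) | take-all k W len≤k = refl

height-suc-≤ : ∀ W k → height W (suc k) ℤ.≤ ℤ.suc (height W k)
height-suc-≤ W k with k <? length W
... | no k≮ = ℤ.≤-trans (ℤ.≤-reflexive (height-stalls W k (≮⇒≥ k≮))) (ℤ.i≤suc[i] (height W k))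
... | yes k< with height-step W k k<
...   | rise _ h≡ = ℤ.≤-reflexive h≡
...   | fall _ h≡ = ℤ.≤-trans (ℤ.≤-reflexive h≡)
                      (ℤ.<⇒≤ (ℤ.<-trans (pred[i]<i (height W k)) (i<suc[i] (height W k))))

pred-height-≤ : ∀ W k → ℤ.pred (height W k) ℤ.≤ height W (suc k)
pred-height-≤ W k with k <? length W
... | no k≮ = ℤ.≤-trans (ℤ.<⇒≤ (pred[i]<i (height W k))) (ℤ.≤-reflexive (sym (height-stalls W k (≮⇒≥ k≮))))
... | yes k< with height-step W k k<
...   | fall _ h≡ = ℤ.≤-reflexive (sym h≡)
...   | rise _ h≡ = ℤ.≤-trans (ℤ.<⇒≤ (ℤ.<-trans (pred[i]<i (height W k)) (i<suc[i] (height W k))))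
                      (ℤ.≤-reflexive (sym h≡))

cross-sum⇔difference : ∀ a b a′ b′ → (a + b′ ≡ b + a′) ⇔ (ℤ.+ a ℤ.- ℤ.+ b ≡ ℤ.+ a′ ℤ.- ℤ.+ b′)
cross-sum⇔difference a b a′ b′ = mk⇔
  (λ eq → ℤ.i-j≡0⇒i≡j _ _ (trans difference
    (trans (cong (λ c → ℤ.+ c ℤ.- ℤ.+ (b + a′)) eq) (ℤ.+-inverseʳ (ℤ.+ (b + a′))))))
  (λ eq → ℤ.+-injective (ℤ.i-j≡0⇒i≡j _ _ (trans (sym difference)
    (trans (cong (ℤ._- _) eq) (ℤ.+-inverseʳ (ℤ.+ a′ ℤ.- ℤ.+ b′))))))
  where
  difference-identity : ∀ (x y x′ y′ : ℤ.ℤ) → (x ℤ.- y) ℤ.- (x′ ℤ.- y′) ≡ (x ℤ.+ y′) ℤ.- (y ℤ.+ x′)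
  difference-identity = solve-∀
  difference : (ℤ.+ a ℤ.- ℤ.+ b) ℤ.- (ℤ.+ a′ ℤ.- ℤ.+ b′) ≡ ℤ.+ (a + b′) ℤ.- ℤ.+ (b + a′)
  difference = difference-identity (ℤ.+ a) (ℤ.+ b) (ℤ.+ a′) (ℤ.+ b′)

sameHeight-true : ∀ W i j → height W i ≡ height W j → sameHeight W i j ≡ true
sameHeight-true W i j eq = ≡ᵇ-true (Equivalence.from (cross-sum⇔difference (#u W i) (#d W i) (#u W j) (#d W j)) eq)

sameHeight-false : ∀ W i j → height W i ≢ height W j → sameHeight W i j ≡ false
sameHeight-false W i j ne = ≡ᵇ-false (ne ∘ Equivalence.to (cross-sum⇔difference (#u W i) (#d W i) (#u W j) (#d W j)))

interval : ℕ → ℕ → List ℕ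
interval a zero    = []
interval a (suc k) = a ∷ interval (suc a) k

range≡interval : ∀ a b → range a b ≡ interval a (suc b ∸ a)
range≡interval a b = go (suc b ∸ a) a refl
  where
  go : ∀ k a → suc b ∸ a ≡ k → range a b ≡ interval a k
  go zero    a eq rewrite eq = refl
  go (suc k) a eq with a ≤? b
  ... | yes a≤b rewrite +-∸-assoc 1 a≤b =
        cong (a ∷_) (go k (suc a) (suc-injective eq))
  ... | no  a≰b = ⊥-elim (1+n≢0 (trans (sym eq) (m≤n⇒m∸n≡0 (≰⇒> a≰b))))

length-interval : ∀ a k → length (interval a k) ≡ k
length-interval a zero    = refl
length-interval a (suc k) = cong suc (length-interval (suc a) k)

interval-∷ʳ : ∀ a k → interval a (suc k) ≡ interval a k ++ (a + k ∷ [])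
interval-∷ʳ a zero    = cong (_∷ []) (sym (+-identityʳ a))
interval-∷ʳ a (suc k) =
  cong (a ∷_) (trans (interval-∷ʳ (suc a) k) (cong (λ z → interval (suc a) k ++ (z ∷ [])) (sym (+-suc a k))))

countdown : ℕ → List ℕ
countdown zero    = []
countdown (suc m) = suc m ∷ countdown m

reverse-interval : ∀ m → reverse (interval 1 m) ≡ countdown m
reverse-interval zero    = refl
reverse-interval (suc m) = begin
  reverse (interval 1 (suc m))            ≡⟨ cong reverse (interval-∷ʳ 1 m) ⟩
  reverse (interval 1 m ++ (suc m ∷ []))  ≡⟨ reverse-++ (interval 1 m) (suc m ∷ []) ⟩
  suc m ∷ reverse (interval 1 m)          ≡⟨ cong (suc m ∷_) (reverse-interval m) ⟩
  countdown (suc m)                       ∎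
  where open ≡-Reasoning

a<a+suc : ∀ a k → a < a + suc k
a<a+suc a k = subst (a <_) (sym (+-suc a k)) (s≤s (m≤m+n a k))

first-interval : ∀ P k a x → a ≤ x → x < a + k → P x ≡ true →
                 (∀ y → a ≤ y → y < x → P y ≡ false) → first P (interval a k) ≡ x
first-interval P zero    a x a≤x x< _ _ = ⊥-elim (<⇒≱ x< (subst (_≤ x) (sym (+-identityʳ a)) a≤x))
first-interval P (suc k) a x a≤x x< Px before with m≤n⇒m<n∨m≡n a≤x
... | inj₂ refl rewrite Px = refl
... | inj₁ a<x rewrite before a ≤-refl a<x =
      first-interval P k (suc a) x a<x (subst (x <_) (+-suc a k) x<) Px (λ y a<y → before y (<⇒≤ a<y))

first-countdown : ∀ P m x → 1 ≤ x → x ≤ m → P x ≡ true →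
                  (∀ y → x < y → y ≤ m → P y ≡ false) → first P (countdown m) ≡ x
first-countdown P zero    x 1≤x x≤0 _ _ = ⊥-elim (<⇒≱ 1≤x x≤0)
first-countdown P (suc m) x 1≤x x≤ Px after with m≤n⇒m<n∨m≡n x≤
... | inj₂ refl rewrite Px = refl
... | inj₁ x<  rewrite after (suc m) x< ≤-refl =
      first-countdown P m x 1≤x (≤-pred x<) Px (λ y x<y y≤ → after y x<y (m≤n⇒m≤1+n y≤))

any-interval-true : ∀ Q k a j → a ≤ j → j < a + k → Q j ≡ true → any Q (interval a k) ≡ true
any-interval-true Q zero    a j a≤j j< _ = ⊥-elim (<⇒≱ j< (subst (_≤ j) (sym (+-identityʳ a)) a≤j))
any-interval-true Q (suc k) a j a≤j j< Qj with m≤n⇒m<n∨m≡n a≤j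
... | inj₂ refl rewrite Qj = refl
... | inj₁ a<j with Q a
...   | true  = refl
...   | false = any-interval-true Q k (suc a) j a<j (subst (j <_) (+-suc a k) j<) Qj

any-interval-false : ∀ Q k a → (∀ j → a ≤ j → j < a + k → Q j ≡ false) → any Q (interval a k) ≡ false
any-interval-false Q zero    a _     = refl
any-interval-false Q (suc k) a never rewrite never a ≤-refl (a<a+suc a k) =
  any-interval-false Q k (suc a) (λ j a<j j< → never j (<⇒≤ a<j) (subst (j <_) (sym (+-suc a k)) j<))

any-interval-cong : ∀ Q Q′ k a → (∀ j → a ≤ j → j < a + k → Q j ≡ Q′ j) →
                    any Q (interval a k) ≡ any Q′ (interval a k)
any-interval-cong Q Q′ zero    a _  = refl
any-interval-cong Q Q′ (suc k) a eq =
  cong₂ _∨_ (eq a ≤-refl (a<a+suc a k))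
            (any-interval-cong Q Q′ k (suc a) (λ j a<j j< → eq j (<⇒≤ a<j) (subst (j <_) (sym (+-suc a k)) j<)))

map-interval-cong : ∀ {A : Set} (f g : ℕ → A) k a → (∀ j → a ≤ j → j < a + k → f j ≡ g j) →
                    map f (interval a k) ≡ map g (interval a k)
map-interval-cong f g zero    a _  = refl
map-interval-cong f g (suc k) a eq =
  cong₂ _∷_ (eq a ≤-refl (a<a+suc a k))
            (map-interval-cong f g k (suc a) (λ j a<j j< → eq j (<⇒≤ a<j) (subst (j <_) (sym (+-suc a k)) j<)))

letter-map-interval : ∀ (f : ℕ → Step) k a i → i < k → letter (map f (interval a k)) (suc i) ≡ f (a + i)
letter-map-interval f (suc k) a zero    _       = cong f (sym (+-identityʳ a))
letter-map-interval f (suc k) a (suc i) (s≤s i<) = trans (letter-map-interval f k (suc a) i i<) (cong f (sym (+-suc a i)))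

word-ext : ∀ W V → length W ≡ length V → (∀ i → i < length W → letter W (suc i) ≡ letter V (suc i)) → W ≡ V
word-ext []      []      _   _  = refl
word-ext (x ∷ W) (y ∷ V) len eq =
  cong₂ _∷_ (eq 0 (s≤s z≤n)) (word-ext W V (suc-injective len) (λ i i< → eq (suc i) (s≤s i<)))

-- Tunnels via heights

tunnel-opener : ∀ W p′ q → letter W (suc p′) ≡ u → suc p′ < q → q ≤ length W →
                height W q ≡ height W p′ →
                (∀ t → suc p′ ≤ t → t < q → height W t ≢ height W p′) → tunnel W (suc p′) ≡ q
tunnel-opener W p′ q letter≡u p<q q≤ same differ with letter W (suc p′)
... | d = ⊥-elim (u≢d (sym letter≡u))
... | u = begin
  first Q (range (suc p) (length W))                  ≡⟨ cong (first Q) (range≡interval (suc p) (length W)) ⟩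
  first Q (interval (suc p) (length W ∸ p))            ≡⟨ first-interval Q (length W ∸ p) (suc p) q p<q q<end
                                                           (sameHeight-true W q p′ same)
                                                           (λ t p<t t<q → sameHeight-false W t p′ (differ t (<⇒≤ p<t) t<q)) ⟩
  q                                                    ∎
  where
  open ≡-Reasoning
  p : ℕ
  p = suc p′
  Q : ℕ → Bool
  Q = λ q → sameHeight W q p′
  q<end : q < suc p + (length W ∸ p)
  q<end = s≤s (subst (q ≤_) (sym (m+[n∸m]≡n (≤-trans (<⇒≤ p<q) q≤))) q≤)

tunnel-closer : ∀ W p′ a′ → letter W (suc p′) ≡ d → a′ < p′ →
                height W a′ ≡ height W (suc p′) →
                (∀ t → a′ < t → t < p′ → height W t ≢ height W (suc p′)) → tunnel W (suc p′) ≡ suc a′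
tunnel-closer W p′ a′ letter≡d a<p same differ with letter W (suc p′)
... | u = ⊥-elim (u≢d letter≡d)
... | d = begin
  first Q (reverse (range 1 p′))       ≡⟨ cong (first Q ∘ reverse) (range≡interval 1 p′) ⟩
  first Q (reverse (interval 1 p′))    ≡⟨ cong (first Q) (reverse-interval p′) ⟩
  first Q (countdown p′)               ≡⟨ first-countdown Q p′ (suc a′) (s≤s z≤n) a<p (sameHeight-true W a′ p same) later ⟩
  suc a′                               ∎
  where
  open ≡-Reasoning
  p : ℕ
  p = suc p′
  Q : ℕ → Bool
  Q = λ q → sameHeight W (q ∸ 1) p
  later : ∀ y → suc a′ < y → y ≤ p′ → Q y ≡ false
  later (suc t) a<t t≤ = sameHeight-false W t p (differ t (≤-pred a<t) t≤)

-- Discrete intermediate values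

module _ (f : ℕ → ℤ.ℤ) where

  record FirstReturn (c : ℤ.ℤ) (r : ℕ) (bound : ℕ) : Set where
    constructor first-return
    field
      at     : ℕ
      after  : r < at
      within : at ≤ bound
      hits   : f at ≡ c
      above  : ∀ t → r ≤ t → t < at → c ℤ.< f t

  extend-above-left : ∀ {c r q} → c ℤ.< f r → (∀ t → suc r ≤ t → t < q → c ℤ.< f t) →
                      ∀ t → r ≤ t → t < q → c ℤ.< f t
  extend-above-left c<fr above t r≤t t<q with m≤n⇒m<n∨m≡n r≤t
  ... | inj₁ r<t  = above t r<t t<q
  ... | inj₂ refl = c<fr

  extend-above-right : ∀ {c a r} → c ℤ.< f (suc r) → (∀ t → a < t → t ≤ r → c ℤ.< f t) →
                       ∀ t → a < t → t ≤ suc r → c ℤ.< f t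
  extend-above-right c<fsr above t a<t t≤sr with m≤n⇒m<n∨m≡n t≤sr
  ... | inj₁ t<sr = above t a<t (≤-pred t<sr)
  ... | inj₂ refl = c<fsr

  find-first-return : (∀ k → ℤ.pred (f k) ℤ.≤ f (suc k)) →
                      ∀ {c} g r → c ℤ.< f r → f (r + g) ℤ.≤ c → FirstReturn c r (r + g)
  find-first-return step zero r c<fr fr≤c =
    ⊥-elim (ℤ.<-irrefl refl (ℤ.<-≤-trans c<fr (subst (λ x → f x ℤ.≤ _) (+-identityʳ r) fr≤c)))
  find-first-return step {c} (suc g) r c<fr end≤c with f (suc r) ℤ.≟ c
  ... | yes hit = first-return (suc r) (n<1+n r) (subst (suc r ≤_) (sym (+-suc r g)) (s≤s (m≤m+n r g))) hit
                    (extend-above-left c<fr (λ t sr≤t t<sr → ⊥-elim (<⇒≱ t<sr sr≤t)))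
  ... | no miss =
    let first-return q sr<q q≤ hits above =
          find-first-return step g (suc r) c<fsr (subst (λ x → f x ℤ.≤ c) (+-suc r g) end≤c)
    in first-return q (<-trans (n<1+n r) sr<q) (subst (q ≤_) (sym (+-suc r g)) q≤) hits (extend-above-left c<fr above)
    where
    c<fsr : c ℤ.< f (suc r)
    c<fsr = ℤ.≤∧≢⇒< (ℤ.≤-trans (ℤ.i<j⇒i≤pred[j] c<fr) (step r)) (miss ∘ sym)

  record LastDeparture (c : ℤ.ℤ) (r : ℕ) : Set where
    constructor last-departure
    field
      at     : ℕ
      before : at < r
      hits   : f at ≡ c
      above  : ∀ t → at < t → t ≤ r → c ℤ.< f t

  find-last-departure : (∀ k → f (suc k) ℤ.≤ ℤ.suc (f k)) →
                        ∀ {c} r → c ℤ.< f r → f 0 ℤ.≤ c → LastDeparture c r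
  find-last-departure step zero c<f0 f0≤c = ⊥-elim (ℤ.<-irrefl refl (ℤ.<-≤-trans c<f0 f0≤c))
  find-last-departure step {c} (suc r) c<fsr f0≤c with f r ℤ.≟ c
  ... | yes hit = last-departure r (n<1+n r) hit
                    (extend-above-right c<fsr (λ t r<t t≤r → ⊥-elim (<⇒≱ r<t t≤r)))
  ... | no miss =
    let last-departure a a<r hits above = find-last-departure step r c<fr f0≤c
    in last-departure a (<-trans a<r (n<1+n r)) hits (extend-above-right c<fsr above)
    where
    c≤fr : c ℤ.≤ f r
    c≤fr = subst₂ ℤ._≤_ (ℤ.pred-suc c) (ℤ.pred-suc (f r))
             (ℤ.pred-mono (ℤ.≤-trans (ℤ.i<j⇒suc[i]≤j c<fsr) (step r)))
    c<fr : c ℤ.< f r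
    c<fr = ℤ.≤∧≢⇒< c≤fr (miss ∘ sym)

-- Noncrossing matchings

record IsNoncrossingMatching (N : ℕ) (M : ℕ → ℕ) : Set where
  field
    ≥1            : ∀ x → 1 ≤ x → x ≤ N → 1 ≤ M x
    ≤N            : ∀ x → 1 ≤ x → x ≤ N → M x ≤ N
    involutive    : ∀ x → 1 ≤ x → x ≤ N → M (M x) ≡ x
    fixpoint-free : ∀ x → 1 ≤ x → x ≤ N → M x ≢ x
    noncrossing   : ∀ a b → 1 ≤ a → a < b → b ≤ N → b < M a → M a < M b → ⊥

UnionOfArcs : (ℕ → ℕ) → ℕ → ℕ → Set
UnionOfArcs M L R = ∀ y → L < y → y ≤ R → L < M y × M y ≤ R

shorter-interval : ∀ {L L′ R′ R} → L < L′ → L′ ≤ R′ → R′ ≤ R → R′ ∸ L′ < R ∸ L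
shorter-interval {L} L<L′ L′≤R′ R′≤R = <-≤-trans (∸-monoʳ-< L<L′ L′≤R′) (∸-monoˡ-≤ L R′≤R)

module NoncrossingMatching {N M} (nc : IsNoncrossingMatching N M) where
  open IsNoncrossingMatching nc

  nested-arc : ∀ a → 1 ≤ a → a ≤ N → a < M a → ∀ y → a < y → y < M a → a < M y × M y < M a
  nested-arc a 1≤a a≤N a<Ma y a<y y<Ma = lower , upper
    where
    1≤y : 1 ≤ y
    1≤y = ≤-trans 1≤a (<⇒≤ a<y)
    y≤N : y ≤ N
    y≤N = ≤-trans (<⇒≤ y<Ma) (≤N a 1≤a a≤N)
    MMy≡y : M (M y) ≡ y
    MMy≡y = involutive y 1≤y y≤N
    lower : a < M y
    lower with <-cmp (M y) a
    ... | tri< My<a _ _ = ⊥-elim (noncrossing (M y) a (≥1 y 1≤y y≤N) My<a a≤N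
                            (subst (a <_) (sym MMy≡y) a<y) (subst (_< M a) (sym MMy≡y) y<Ma))
    ... | tri≈ _ My≡a _ = ⊥-elim (<-irrefl (trans (sym MMy≡y) (cong M My≡a)) y<Ma)
    ... | tri> _ _ a<My = a<My
    upper : M y < M a
    upper with <-cmp (M y) (M a)
    ... | tri< My<Ma _ _ = My<Ma
    ... | tri≈ _ My≡Ma _ = ⊥-elim (<-irrefl (trans (sym (involutive a 1≤a a≤N)) (trans (cong M (sym My≡Ma)) MMy≡y)) a<y)
    ... | tri> _ _ Ma<My = ⊥-elim (noncrossing a y 1≤a a<y y≤N y<Ma Ma<My)

  beyond-arc : ∀ a → 1 ≤ a → a ≤ N → a < M a → ∀ y → M a < y → y ≤ N → a ≤ M y → M a < M y
  beyond-arc a 1≤a a≤N a<Ma y Ma<y y≤N a≤My = beyond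
    where
    MMy≡y : M (M y) ≡ y
    MMy≡y = involutive y (≤-trans 1≤a (<⇒≤ (<-trans a<Ma Ma<y))) y≤N
    beyond : M a < M y
    beyond with <-cmp (M y) (M a)
    ... | tri> _ _ Ma<My = Ma<My
    ... | tri≈ _ My≡Ma _ = ⊥-elim (<-irrefl (trans (sym (involutive a 1≤a a≤N)) (trans (cong M (sym My≡Ma)) MMy≡y))
                                           (<-trans a<Ma Ma<y))
    ... | tri< My<Ma _ _ with m≤n⇒m<n∨m≡n a≤My
    ...   | inj₂ a≡My = ⊥-elim (<-irrefl (trans (cong M a≡My) MMy≡y) Ma<y)
    ...   | inj₁ a<My = ⊥-elim (<-asym Ma<y (subst (_< M a) MMy≡y (proj₂ (nested-arc a 1≤a a≤N a<Ma (M y) a<My My<Ma))))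

  opens-first : ∀ L R → L < R → R ≤ N → UnionOfArcs M L R → suc L < M (suc L) × M (suc L) ≤ R
  opens-first L R L<R R≤N arcs with proj₁ (arcs (suc L) ≤-refl L<R) | proj₂ (arcs (suc L) ≤-refl L<R)
  ... | L<C | C≤R with m≤n⇒m<n∨m≡n L<C
  ...   | inj₁ S<C = S<C , C≤R
  ...   | inj₂ S≡C = ⊥-elim (fixpoint-free (suc L) (s≤s z≤n) (≤-trans L<R R≤N) (sym S≡C))

  inner-union : ∀ a c′ → 1 ≤ a → a ≤ N → M a ≡ suc c′ → a < M a → UnionOfArcs M a c′
  inner-union a c′ 1≤a a≤N Ma≡ a<Ma y a<y y≤c′ =
    let a<My , My<Ma = nested-arc a 1≤a a≤N a<Ma y a<y (subst (y <_) (sym Ma≡) (s≤s y≤c′))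
    in a<My , ≤-pred (subst (M y <_) Ma≡ My<Ma)

  outer-union : ∀ L R → R ≤ N → UnionOfArcs M L R → suc L < M (suc L) → UnionOfArcs M (M (suc L)) R
  outer-union L R R≤N arcs S<C y C<y y≤R =
    beyond-arc (suc L) (s≤s z≤n) (≤-trans (<⇒≤ S<C) C≤N) S<C y C<y (≤-trans y≤R R≤N) (proj₁ (arcs y L<y y≤R)) ,
    proj₂ (arcs y L<y y≤R)
    where
    C≤N : M (suc L) ≤ N
    C≤N = ≤-trans (<⇒≤ C<y) (≤-trans y≤R R≤N)
    L<y : L < y
    L<y = <-trans (n<1+n L) (<-trans S<C C<y)

-- The Dyck path of a noncrossing matching

UpAtOpeners : ℕ → (ℕ → ℕ) → Word → Set
UpAtOpeners N M W = ∀ k → 1 ≤ k → k ≤ N → (k < M k → letter W k ≡ u) × (M k < k → letter W k ≡ d)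

module MatchingWord (n : ℕ) {M} (nc : IsNoncrossingMatching (2 * n) M) (W : Word)
                    (length≡ : length W ≡ 2 * n) (letters : UpAtOpeners (2 * n) M W) where
  open IsNoncrossingMatching nc
  open NoncrossingMatching nc

  private
    N : ℕ
    N = 2 * n
    h : ℕ → ℤ.ℤ
    h = height W

  opener-rises : ∀ p′ → suc p′ ≤ N → suc p′ < M (suc p′) → h (suc p′) ≡ ℤ.suc (h p′)
  opener-rises p′ P≤N P<MP with height-step W p′ (subst (p′ <_) (sym length≡) P≤N)
  ... | rise _ eq = eq
  ... | fall l _  = ⊥-elim (u≢d (trans (sym (proj₁ (letters (suc p′) (s≤s z≤n) P≤N) P<MP)) l))

  closer-falls : ∀ p′ → suc p′ ≤ N → M (suc p′) < suc p′ → h (suc p′) ≡ ℤ.pred (h p′)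
  closer-falls p′ P≤N MP<P with height-step W p′ (subst (p′ <_) (sym length≡) P≤N)
  ... | fall _ eq = eq
  ... | rise l _  = ⊥-elim (u≢d (trans (sym l) (proj₂ (letters (suc p′) (s≤s z≤n) P≤N) MP<P)))

  -- The arc at L + 1 splits (L, R] into its inside, one level higher, and the rest, at level h L.
  union-heights : ∀ L R → L ≤ R → R ≤ N → UnionOfArcs M L R → Acc _<_ (R ∸ L) →
                  h R ≡ h L × (∀ q → L ≤ q → q ≤ R → h L ℤ.≤ h q)
  union-heights L R L≤R R≤N arcs (acc rec) with m≤n⇒m<n∨m≡n L≤R
  ... | inj₂ refl = refl , λ q L≤q q≤L → ℤ.≤-reflexive (cong h (≤-antisym L≤q q≤L))
  ... | inj₁ L<R with M (suc L) in C≡ | opens-first L R L<R R≤N arcs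
  ...   | suc c′ | S<C , C≤R = trans (proj₁ outer) hC≡hL , bound
    where
    S : ℕ
    S = suc L
    S≤N : S ≤ N
    S≤N = ≤-trans (<⇒≤ S<C) (≤-trans C≤R R≤N)
    S<MS : S < M S
    S<MS = subst (S <_) (sym C≡) S<C
    hS≡ : h S ≡ ℤ.suc (h L)
    hS≡ = opener-rises L S≤N S<MS
    inner : h c′ ≡ h S × (∀ q → S ≤ q → q ≤ c′ → h S ℤ.≤ h q)
    inner = union-heights S c′ (≤-pred S<C) (≤-trans (n≤1+n c′) (≤-trans C≤R R≤N))
              (inner-union S c′ (s≤s z≤n) S≤N C≡ S<MS)
              (rec (shorter-interval (n<1+n L) (≤-pred S<C) (≤-trans (n≤1+n c′) C≤R)))
    outer : h R ≡ h (suc c′) × (∀ q → suc c′ ≤ q → q ≤ R → h (suc c′) ℤ.≤ h q)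
    outer = union-heights (suc c′) R C≤R R≤N
              (subst (λ C → UnionOfArcs M C R) C≡ (outer-union L R R≤N arcs S<MS))
              (rec (shorter-interval (<-trans (n<1+n L) S<C) C≤R ≤-refl))
    MC≡S : M (suc c′) ≡ S
    MC≡S = trans (cong M (sym C≡)) (involutive S (s≤s z≤n) S≤N)
    hC≡hL : h (suc c′) ≡ h L
    hC≡hL = begin
      h (suc c′)            ≡⟨ closer-falls c′ (≤-trans C≤R R≤N) (subst (_< suc c′) (sym MC≡S) S<C) ⟩
      ℤ.pred (h c′)         ≡⟨ cong ℤ.pred (trans (proj₁ inner) hS≡) ⟩
      ℤ.pred (ℤ.suc (h L))  ≡⟨ ℤ.pred-suc (h L) ⟩
      h L                   ∎
      where open ≡-Reasoning
    bound : ∀ q → L ≤ q → q ≤ R → h L ℤ.≤ h q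
    bound q L≤q q≤R with q ≤? c′
    ... | no  q≰c′ = subst (ℤ._≤ h q) hC≡hL (proj₂ outer q (≰⇒> q≰c′) q≤R)
    ... | yes q≤c′ with m≤n⇒m<n∨m≡n L≤q
    ...   | inj₂ refl = ℤ.≤-refl
    ...   | inj₁ S≤q  = ℤ.<⇒≤ (ℤ.<-≤-trans (subst (h L ℤ.<_) (sym hS≡) (i<suc[i] (h L))) (proj₂ inner q S≤q q≤c′))

  arc-heights : ∀ p′ → suc p′ ≤ N → suc p′ < M (suc p′) →
                h (M (suc p′)) ≡ h p′ × (∀ q → suc p′ ≤ q → q < M (suc p′) → h p′ ℤ.< h q)
  arc-heights p′ P≤N P<MP with M (suc p′) in E≡
  ... | suc e′ = hE≡ , above
    where
    P : ℕ
    P = suc p′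
    E≤N : suc e′ ≤ N
    E≤N = subst (_≤ N) E≡ (≤N P (s≤s z≤n) P≤N)
    inner : h e′ ≡ h P × (∀ q → P ≤ q → q ≤ e′ → h P ℤ.≤ h q)
    inner = union-heights P e′ (≤-pred P<MP) (≤-trans (n≤1+n e′) E≤N)
              (inner-union P e′ (s≤s z≤n) P≤N E≡ (subst (P <_) (sym E≡) P<MP)) (<-wellFounded _)
    hP≡ : h P ≡ ℤ.suc (h p′)
    hP≡ = opener-rises p′ P≤N (subst (P <_) (sym E≡) P<MP)
    ME≡P : M (suc e′) ≡ P
    ME≡P = trans (cong M (sym E≡)) (involutive P (s≤s z≤n) P≤N)
    hE≡ : h (suc e′) ≡ h p′
    hE≡ = begin
      h (suc e′)             ≡⟨ closer-falls e′ E≤N (subst (_< suc e′) (sym ME≡P) P<MP) ⟩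
      ℤ.pred (h e′)          ≡⟨ cong ℤ.pred (trans (proj₁ inner) hP≡) ⟩
      ℤ.pred (ℤ.suc (h p′))  ≡⟨ ℤ.pred-suc (h p′) ⟩
      h p′                   ∎
      where open ≡-Reasoning
    above : ∀ q → P ≤ q → q < suc e′ → h p′ ℤ.< h q
    above q P≤q q<E = ℤ.<-≤-trans (subst (h p′ ℤ.<_) (sym hP≡) (i<suc[i] (h p′))) (proj₂ inner q P≤q (≤-pred q<E))

  private
    whole : h N ≡ h 0 × (∀ q → 0 ≤ q → q ≤ N → h 0 ℤ.≤ h q)
    whole = union-heights 0 N z≤n ≤-refl (λ y 0<y y≤N → ≥1 y 0<y y≤N , ≤N y 0<y y≤N) (<-wellFounded _)

    #u≡#d : #u W N ≡ #d W N
    #u≡#d = trans (sym (+-identityʳ _))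
              (trans (Equivalence.from (cross-sum⇔difference _ _ 0 0) (proj₁ whole)) (+-identityʳ _))

    #u≡n : #u W N ≡ n
    #u≡n = *-cancelˡ-≡ (#u W N) n 2 (begin
      2 * #u W N         ≡⟨ cong (#u W N +_) (+-identityʳ (#u W N)) ⟩
      #u W N + #u W N    ≡⟨ cong (#u W N +_) #u≡#d ⟩
      #u W N + #d W N    ≡⟨ #u+#d≡k W N (≤-reflexive (sym length≡)) ⟩
      2 * n              ∎)
      where open ≡-Reasoning

  is-dyck : IsDyck n W
  is-dyck = length≡ , #u≡n , trans (sym #u≡#d) #u≡n ,
            λ k k≤N → ℤ.drop‿+≤+ (ℤ.0≤i-j⇒j≤i (proj₂ whole k z≤n k≤N))

  private
    tunnel-at-closer : ∀ p′ A → M (suc p′) ≡ A → A < suc p′ → suc p′ ≤ N → tunnel W (suc p′) ≡ A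
    tunnel-at-closer p′ zero     MP≡0 _ P≤N = ⊥-elim (<⇒≱ (≥1 (suc p′) (s≤s z≤n) P≤N) (≤-reflexive MP≡0))
    tunnel-at-closer p′ (suc a′) MP≡A A<P P≤N =
      tunnel-closer W p′ a′ (proj₂ (letters P (s≤s z≤n) P≤N) (subst (_< P) (sym MP≡A) A<P)) (≤-pred A<P)
        (sym hP≡ha′)
        (λ t a′<t t<p′ ht≡hP → ℤ.<-irrefl (sym (trans ht≡hP hP≡ha′))
                                  (proj₂ arc t a′<t (subst (t <_) (sym MA≡P) (<-trans t<p′ (n<1+n p′)))))
      where
      P : ℕ
      P = suc p′
      A≤N : suc a′ ≤ N
      A≤N = ≤-trans (<⇒≤ A<P) P≤N
      MA≡P : M (suc a′) ≡ P
      MA≡P = trans (cong M (sym MP≡A)) (involutive P (s≤s z≤n) P≤N)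
      arc : h (M (suc a′)) ≡ h a′ × (∀ q → suc a′ ≤ q → q < M (suc a′) → h a′ ℤ.< h q)
      arc = arc-heights a′ A≤N (subst (suc a′ <_) (sym MA≡P) A<P)
      hP≡ha′ : h P ≡ h a′
      hP≡ha′ = trans (cong h (sym MA≡P)) (proj₁ arc)

  tunnel≡matching : ∀ p → 1 ≤ p → p ≤ N → tunnel W p ≡ M p
  tunnel≡matching (suc p′) 1≤P P≤N with <-cmp (suc p′) (M (suc p′))
  ... | tri≈ _ P≡MP _ = ⊥-elim (fixpoint-free (suc p′) 1≤P P≤N (sym P≡MP))
  ... | tri> _ _ MP<P = tunnel-at-closer p′ (M (suc p′)) refl MP<P P≤N
  ... | tri< P<MP _ _ =
    tunnel-opener W p′ (M (suc p′)) (proj₁ (letters (suc p′) 1≤P P≤N) P<MP) P<MP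
      (subst (M (suc p′) ≤_) (sym length≡) (≤N (suc p′) 1≤P P≤N)) (proj₁ arc)
      (λ t P≤t t<MP ht≡hp → ℤ.<-irrefl (sym ht≡hp) (proj₂ arc t P≤t t<MP))
    where
    arc : h (M (suc p′)) ≡ h p′ × (∀ q → suc p′ ≤ q → q < M (suc p′) → h p′ ℤ.< h q)
    arc = arc-heights p′ P≤N P<MP

-- The matching of a Dyck path

letter-cases : ∀ W p → letter W p ≡ u ⊎ letter W p ≡ d
letter-cases W p with letter W p
... | u = inj₁ refl
... | d = inj₂ refl

module DyckPath (n : ℕ) (D : Word) (dyck : IsDyck n D) where

  private
    N : ℕ
    N = 2 * n
    h : ℕ → ℤ.ℤ
    h = height D
    τ : ℕ → ℕ
    τ = tunnel D

    length≡ : length D ≡ N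
    length≡ = proj₁ dyck

    height-nonneg : ∀ k → k ≤ N → ℤ.0ℤ ℤ.≤ h k
    height-nonneg k k≤N = ℤ.i≤j⇒0≤j-i (ℤ.+≤+ (proj₂ (proj₂ (proj₂ dyck)) k k≤N))

    height-end : h N ≡ ℤ.0ℤ
    height-end = Equivalence.to (cross-sum⇔difference _ _ 0 0)
      (trans (+-identityʳ _) (trans (proj₁ (proj₂ dyck))
        (trans (sym (proj₁ (proj₂ (proj₂ dyck)))) (sym (+-identityʳ _)))))

  record ArcFrom (p′ q : ℕ) : Set where
    field
      after  : suc p′ < q
      within : q ≤ N
      closes : h q ≡ h p′
      above  : ∀ t → suc p′ ≤ t → t < q → h p′ ℤ.< h t

  OpenerArc : ℕ → Set
  OpenerArc p′ = ArcFrom p′ (τ (suc p′))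

  opener-arc : ∀ p′ → suc p′ ≤ N → letter D (suc p′) ≡ u → OpenerArc p′
  opener-arc p′ P≤N letter≡u = arc (find-first-return h (pred-height-≤ D) (N ∸ P) P hp′<hP end≤)
    where
    P : ℕ
    P = suc p′
    hp′<hP : h p′ ℤ.< h P
    hp′<hP with height-step D p′ (subst (p′ <_) (sym length≡) P≤N)
    ... | rise _ eq = subst (h p′ ℤ.<_) (sym eq) (i<suc[i] (h p′))
    ... | fall l _  = ⊥-elim (u≢d (trans (sym letter≡u) l))
    end≤ : h (P + (N ∸ P)) ℤ.≤ h p′
    end≤ = subst (λ k → h k ℤ.≤ h p′) (sym (m+[n∸m]≡n P≤N))
             (subst (ℤ._≤ h p′) (sym height-end) (height-nonneg p′ (≤-trans (n≤1+n p′) P≤N)))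
    arc : FirstReturn h (h p′) P (P + (N ∸ P)) → OpenerArc p′
    arc (first-return q P<q q≤ hits above) = subst (ArcFrom p′) (sym τ≡q)
      record { after = P<q ; within = subst (q ≤_) (m+[n∸m]≡n P≤N) q≤ ; closes = hits ; above = above }
      where
      τ≡q : τ P ≡ q
      τ≡q = tunnel-opener D p′ q letter≡u P<q (subst (q ≤_) (trans (m+[n∸m]≡n P≤N) (sym length≡)) q≤) hits
              (λ t P≤t t<q ht≡ → ℤ.<-irrefl (sym ht≡) (above t P≤t t<q))

  record CloserArc (p′ : ℕ) : Set where
    field
      start   : ℕ
      tunnel≡ : τ (suc p′) ≡ suc start
      before  : start < p′
      opens   : h start ≡ h (suc p′)
      above   : ∀ t → start < t → t ≤ p′ → h (suc p′) ℤ.< h t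

  closer-arc : ∀ p′ → suc p′ ≤ N → letter D (suc p′) ≡ d → CloserArc p′
  closer-arc p′ P≤N letter≡d = arc (find-last-departure h (height-suc-≤ D) p′ hP<hp′ (height-nonneg P P≤N))
    where
    P : ℕ
    P = suc p′
    hP<hp′ : h P ℤ.< h p′
    hP<hp′ with height-step D p′ (subst (p′ <_) (sym length≡) P≤N)
    ... | fall _ eq = subst (ℤ._< h p′) (sym eq) (pred[i]<i (h p′))
    ... | rise l _  = ⊥-elim (u≢d (trans (sym l) letter≡d))
    arc : LastDeparture h (h P) p′ → CloserArc p′
    arc (last-departure a a<p′ hits above) = record
      { start = a ; before = a<p′ ; opens = hits ; above = above
      ; tunnel≡ = tunnel-closer D p′ a letter≡d a<p′ hits
                    (λ t a<t t<p′ ht≡ → ℤ.<-irrefl (sym ht≡) (above t a<t (<⇒≤ t<p′))) }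

  private
    opener-before : ∀ p → 1 ≤ p → p ≤ N → letter D p ≡ u → p < τ p
    opener-before (suc p′) _ P≤N letter≡u = ArcFrom.after (opener-arc p′ P≤N letter≡u)

    closer-after : ∀ p → 1 ≤ p → p ≤ N → letter D p ≡ d → τ p < p
    closer-after (suc p′) _ P≤N letter≡d =
      subst (_< suc p′) (sym (CloserArc.tunnel≡ arc)) (s≤s (CloserArc.before arc))
      where
      arc : CloserArc p′
      arc = closer-arc p′ P≤N letter≡d

    closes-back : ∀ p′ q → ArcFrom p′ q → τ q ≡ suc p′
    closes-back p′ zero    arc = ⊥-elim (<⇒≱ (ArcFrom.after arc) z≤n)
    closes-back p′ (suc q′) arc = tunnel-closer D q′ p′ letter≡d (≤-pred after) (sym closes)
      (λ t p′<t t<q′ ht≡ → ℤ.<-irrefl (sym (trans ht≡ closes)) (above t p′<t (<-trans t<q′ (n<1+n q′))))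
      where
      open ArcFrom arc
      hp′<hq′ : h p′ ℤ.< h q′
      hp′<hq′ = above q′ (≤-pred after) (n<1+n q′)
      letter≡d : letter D (suc q′) ≡ d
      letter≡d with height-step D q′ (subst (q′ <_) (sym length≡) within)
      ... | fall l _ = l
      ... | rise _ eq = ⊥-elim (ℤ.<-asym hp′<hq′ (subst (h q′ ℤ.<_) closes′ (i<suc[i] (h q′))))
        where closes′ : ℤ.suc (h q′) ≡ h p′
              closes′ = trans (sym eq) closes

    opens-back : ∀ p′ → suc p′ ≤ N → (arc : CloserArc p′) → τ (suc (CloserArc.start arc)) ≡ suc p′
    opens-back p′ P≤N arc = tunnel-opener D start (suc p′) letter≡u (s≤s before)
      (subst (suc p′ ≤_) (sym length≡) P≤N) (sym opens)
      (λ t A≤t t<P ht≡ → ℤ.<-irrefl (sym (trans ht≡ opens)) (above t A≤t (≤-pred t<P)))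
      where
      open CloserArc arc
      hP<hA : h (suc p′) ℤ.< h (suc start)
      hP<hA = above (suc start) ≤-refl before
      letter≡u : letter D (suc start) ≡ u
      letter≡u with height-step D start (subst (start <_) (sym length≡) (≤-trans before (≤-trans (n≤1+n p′) P≤N)))
      ... | rise l _ = l
      ... | fall _ eq = ⊥-elim (ℤ.<-asym hP<hA (subst (ℤ._< h (suc p′)) (sym (trans eq (cong ℤ.pred opens)))
                                                  (pred[i]<i (h (suc p′)))))

    τ-involutive : ∀ p → 1 ≤ p → p ≤ N → τ (τ p) ≡ p
    τ-involutive (suc p′) _ P≤N with letter-cases D (suc p′)
    ... | inj₁ letter≡u = closes-back p′ (τ (suc p′)) (opener-arc p′ P≤N letter≡u)
    ... | inj₂ letter≡d = trans (cong τ (CloserArc.tunnel≡ arc)) (opens-back p′ P≤N arc)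
      where
      arc : CloserArc p′
      arc = closer-arc p′ P≤N letter≡d

    τ-noncrossing : ∀ a b → 1 ≤ a → a < b → b ≤ N → b < τ a → τ a < τ b → ⊥
    τ-noncrossing (suc a′) (suc b′) _ a<b b≤N b<τa τa<τb = ℤ.<-asym ha′<hb′ hb′<ha′
      where
      a≤N : suc a′ ≤ N
      a≤N = ≤-trans (<⇒≤ a<b) b≤N
      opener : ∀ p → 1 ≤ p → p ≤ N → ∀ {x} → p < x → x < τ p → letter D p ≡ u
      opener p 1≤p p≤N p<x x<τp with letter-cases D p
      ... | inj₁ letter≡u = letter≡u
      ... | inj₂ letter≡d = ⊥-elim (<-asym (closer-after p 1≤p p≤N letter≡d) (<-trans p<x x<τp))
      A : OpenerArc a′
      A = opener-arc a′ a≤N (opener (suc a′) (s≤s z≤n) a≤N a<b b<τa)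
      B : OpenerArc b′
      B = opener-arc b′ b≤N (opener (suc b′) (s≤s z≤n) b≤N b<τa τa<τb)
      ha′<hb′ : h a′ ℤ.< h b′
      ha′<hb′ = ArcFrom.above A b′ (≤-pred a<b) (<-trans (n<1+n b′) b<τa)
      hb′<ha′ : h b′ ℤ.< h a′
      hb′<ha′ = subst (h b′ ℤ.<_) (ArcFrom.closes A) (ArcFrom.above B (τ (suc a′)) (<⇒≤ b<τa) τa<τb)

    τ-≥1 : ∀ p → 1 ≤ p → p ≤ N → 1 ≤ τ p
    τ-≥1 (suc p′) 1≤P P≤N with letter-cases D (suc p′)
    ... | inj₁ letter≡u = <⇒≤ (≤-<-trans 1≤P (opener-before (suc p′) 1≤P P≤N letter≡u))
    ... | inj₂ letter≡d = subst (1 ≤_) (sym (CloserArc.tunnel≡ (closer-arc p′ P≤N letter≡d))) (s≤s z≤n)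

    τ-≤N : ∀ p → 1 ≤ p → p ≤ N → τ p ≤ N
    τ-≤N (suc p′) 1≤P P≤N with letter-cases D (suc p′)
    ... | inj₁ letter≡u = ArcFrom.within (opener-arc p′ P≤N letter≡u)
    ... | inj₂ letter≡d = ≤-trans (<⇒≤ (closer-after (suc p′) 1≤P P≤N letter≡d)) P≤N

    τ-fixpoint-free : ∀ p → 1 ≤ p → p ≤ N → τ p ≢ p
    τ-fixpoint-free p 1≤p p≤N τp≡p with letter-cases D p
    ... | inj₁ letter≡u = <-irrefl (sym τp≡p) (opener-before p 1≤p p≤N letter≡u)
    ... | inj₂ letter≡d = <-irrefl τp≡p (closer-after p 1≤p p≤N letter≡d)

  tunnel-matching : IsNoncrossingMatching N τ
  tunnel-matching = record
    { ≥1 = τ-≥1 ; ≤N = τ-≤N ; involutive = τ-involutive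
    ; fixpoint-free = τ-fixpoint-free ; noncrossing = τ-noncrossing }

  up-at-openers : UpAtOpeners N τ D
  up-at-openers k 1≤k k≤N with letter-cases D k
  ... | inj₁ letter≡u = (λ _ → letter≡u) , (λ τk<k → ⊥-elim (<-asym τk<k (opener-before k 1≤k k≤N letter≡u)))
  ... | inj₂ letter≡d = (λ k<τk → ⊥-elim (<-asym k<τk (closer-after k 1≤k k≤N letter≡d))) , (λ _ → letter≡d)

-- The action on Dyck paths

act-length : ∀ n σ D → length (act n σ D) ≡ 2 * n
act-length n σ D = begin
  length (map _ (range 1 (2 * n)))        ≡⟨ length-map _ (range 1 (2 * n)) ⟩
  length (range 1 (2 * n))                ≡⟨ cong length (range≡interval 1 (2 * n)) ⟩
  length (interval 1 (2 * n))             ≡⟨ length-interval 1 (2 * n) ⟩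
  2 * n                                   ∎
  where open ≡-Reasoning

act-letter : ∀ n σ D i → i < 2 * n →
  letter (act n σ D) (suc i) ≡ (if any (λ j → tunnel D (σ (suc i)) ≡ᵇ σ j) (range 1 (suc i)) then d else u)
act-letter n σ D i i< =
  trans (cong (λ r → letter (map _ r) (suc i)) (range≡interval 1 (2 * n))) (letter-map-interval _ (2 * n) 1 i i<)

up-at-openers-unique : ∀ {N M} → (∀ x → 1 ≤ x → x ≤ N → M x ≢ x) → ∀ W V → length W ≡ N → length V ≡ N →
                       UpAtOpeners N M W → UpAtOpeners N M V → W ≡ V
up-at-openers-unique {N} {M} fixpoint-free W V lenW lenV W-letters V-letters =
  word-ext W V (trans lenW (sym lenV)) (λ i i< → agree (suc i) (s≤s z≤n) (subst (suc i ≤_) lenW i<))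
  where
  agree : ∀ k → 1 ≤ k → k ≤ N → letter W k ≡ letter V k
  agree k 1≤k k≤N with <-cmp k (M k)
  ... | tri< k<Mk _ _ = trans (proj₁ (W-letters k 1≤k k≤N) k<Mk) (sym (proj₁ (V-letters k 1≤k k≤N) k<Mk))
  ... | tri≈ _ k≡Mk _ = ⊥-elim (fixpoint-free k 1≤k k≤N (sym k≡Mk))
  ... | tri> _ _ Mk<k = trans (proj₂ (W-letters k 1≤k k≤N) Mk<k) (sym (proj₂ (V-letters k 1≤k k≤N) Mk<k))

record InversePair (N : ℕ) (σ σ′ : ℕ → ℕ) : Set where
  field
    to-≥1    : ∀ x → 1 ≤ x → x ≤ N → 1 ≤ σ x
    to-≤N    : ∀ x → 1 ≤ x → x ≤ N → σ x ≤ N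
    from-≥1  : ∀ x → 1 ≤ x → x ≤ N → 1 ≤ σ′ x
    from-≤N  : ∀ x → 1 ≤ x → x ≤ N → σ′ x ≤ N
    inverseˡ : ∀ x → 1 ≤ x → x ≤ N → σ′ (σ x) ≡ x
    inverseʳ : ∀ x → 1 ≤ x → x ≤ N → σ (σ′ x) ≡ x

record ActsOnMatchings (N : ℕ) (σ σ′ : ℕ → ℕ) : Set where
  field
    inverse   : InversePair N σ σ′
    conjugate : ∀ M → IsNoncrossingMatching N M → IsNoncrossingMatching N (σ′ ∘ M ∘ σ)

id-acts : ∀ N → ActsOnMatchings N id id
id-acts N = record
  { inverse   = record { to-≥1 = λ _ 1≤x _ → 1≤x ; to-≤N = λ _ _ x≤N → x≤N
                       ; from-≥1 = λ _ 1≤x _ → 1≤x ; from-≤N = λ _ _ x≤N → x≤N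
                       ; inverseˡ = λ _ _ _ → refl ; inverseʳ = λ _ _ _ → refl }
  ; conjugate = λ _ nc → nc }

∘-acts : ∀ {N σ σ′ π π′} → ActsOnMatchings N σ σ′ → ActsOnMatchings N π π′ →
         ActsOnMatchings N (σ ∘ π) (π′ ∘ σ′)
∘-acts {N} {σ} {σ′} {π} {π′} σ-acts π-acts = record
  { inverse = record
    { to-≥1    = λ x 1≤x x≤N → S.to-≥1 (π x) (P.to-≥1 x 1≤x x≤N) (P.to-≤N x 1≤x x≤N)
    ; to-≤N    = λ x 1≤x x≤N → S.to-≤N (π x) (P.to-≥1 x 1≤x x≤N) (P.to-≤N x 1≤x x≤N)
    ; from-≥1  = λ x 1≤x x≤N → P.from-≥1 (σ′ x) (S.from-≥1 x 1≤x x≤N) (S.from-≤N x 1≤x x≤N)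
    ; from-≤N  = λ x 1≤x x≤N → P.from-≤N (σ′ x) (S.from-≥1 x 1≤x x≤N) (S.from-≤N x 1≤x x≤N)
    ; inverseˡ = λ x 1≤x x≤N →
        trans (cong π′ (S.inverseˡ (π x) (P.to-≥1 x 1≤x x≤N) (P.to-≤N x 1≤x x≤N))) (P.inverseˡ x 1≤x x≤N)
    ; inverseʳ = λ x 1≤x x≤N →
        trans (cong σ (P.inverseʳ (σ′ x) (S.from-≥1 x 1≤x x≤N) (S.from-≤N x 1≤x x≤N))) (S.inverseʳ x 1≤x x≤N)
    }
  ; conjugate = λ M nc → ActsOnMatchings.conjugate π-acts _ (ActsOnMatchings.conjugate σ-acts M nc)
  }
  where
  module S = InversePair (ActsOnMatchings.inverse σ-acts)
  module P = InversePair (ActsOnMatchings.inverse π-acts)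

matching-cong : ∀ {N M M′} → (∀ x → 1 ≤ x → x ≤ N → M′ x ≡ M x) →
                IsNoncrossingMatching N M → IsNoncrossingMatching N M′
matching-cong {N} {M} {M′} M′≗M nc = record
  { ≥1            = λ x 1≤x x≤N → subst (1 ≤_) (sym (M′≗M x 1≤x x≤N)) (≥1 x 1≤x x≤N)
  ; ≤N            = λ x 1≤x x≤N → subst (_≤ N) (sym (M′≗M x 1≤x x≤N)) (≤N x 1≤x x≤N)
  ; involutive    = λ x 1≤x x≤N → begin
      M′ (M′ x)  ≡⟨ cong M′ (M′≗M x 1≤x x≤N) ⟩
      M′ (M x)   ≡⟨ M′≗M (M x) (≥1 x 1≤x x≤N) (≤N x 1≤x x≤N) ⟩
      M (M x)    ≡⟨ involutive x 1≤x x≤N ⟩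
      x          ∎
  ; fixpoint-free = λ x 1≤x x≤N → fixpoint-free x 1≤x x≤N ∘ trans (sym (M′≗M x 1≤x x≤N))
  ; noncrossing   = λ a b 1≤a a<b b≤N →
      let 1≤b = ≤-trans 1≤a (<⇒≤ a<b) in
      subst₂ (λ A B → b < A → A < B → ⊥) (sym (M′≗M a 1≤a (≤-trans (<⇒≤ a<b) b≤N))) (sym (M′≗M b 1≤b b≤N))
        (noncrossing a b 1≤a a<b b≤N)
  }
  where
  open IsNoncrossingMatching nc
  open ≡-Reasoning

acts-cong : ∀ {N σ σ′ π π′} → ActsOnMatchings N σ σ′ → (∀ x → 1 ≤ x → x ≤ N → π x ≡ σ x) →
            InversePair N π π′ → ActsOnMatchings N π π′
acts-cong {N} {σ} {σ′} {π} {π′} σ-acts π≗σ π-inverse = record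
  { inverse   = π-inverse
  ; conjugate = λ M nc → matching-cong (conjugates-agree M nc) (ActsOnMatchings.conjugate σ-acts M nc)
  }
  where
  module S = InversePair (ActsOnMatchings.inverse σ-acts)
  module P = InversePair π-inverse
  π′≗σ′ : ∀ y → 1 ≤ y → y ≤ N → π′ y ≡ σ′ y
  π′≗σ′ y 1≤y y≤N = begin
    π′ y            ≡⟨ S.inverseˡ (π′ y) (P.from-≥1 y 1≤y y≤N) (P.from-≤N y 1≤y y≤N) ⟨
    σ′ (σ (π′ y))   ≡⟨ cong σ′ (π≗σ (π′ y) (P.from-≥1 y 1≤y y≤N) (P.from-≤N y 1≤y y≤N)) ⟨
    σ′ (π (π′ y))   ≡⟨ cong σ′ (P.inverseʳ y 1≤y y≤N) ⟩
    σ′ y            ∎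
    where open ≡-Reasoning
  conjugates-agree : ∀ M → IsNoncrossingMatching N M → ∀ x → 1 ≤ x → x ≤ N → π′ (M (π x)) ≡ σ′ (M (σ x))
  conjugates-agree M nc x 1≤x x≤N = trans (cong (π′ ∘ M) (π≗σ x 1≤x x≤N))
    (π′≗σ′ (M (σ x)) (≥1 (σ x) (S.to-≥1 x 1≤x x≤N) (S.to-≤N x 1≤x x≤N))
                     (≤N (σ x) (S.to-≥1 x 1≤x x≤N) (S.to-≤N x 1≤x x≤N)))
    where open IsNoncrossingMatching nc

module Action (n : ℕ) {σ σ′} (acts : ActsOnMatchings (2 * n) σ σ′) (D : Word) (dyck : IsDyck n D) where
  open ActsOnMatchings acts
  open InversePair inverse

  private
    N : ℕ
    N = 2 * n
    τ : ℕ → ℕ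
    τ = tunnel D
    τ-matching : IsNoncrossingMatching N τ
    τ-matching = DyckPath.tunnel-matching n D dyck
    open IsNoncrossingMatching τ-matching using () renaming (≥1 to τ-≥1; ≤N to τ-≤N)

  letters : UpAtOpeners N (σ′ ∘ τ ∘ σ) (act n σ D)
  letters (suc i) _ k≤N = (λ k<σ′x → trans (act-letter n σ D i k≤N) (cong (λ b → if b then d else u) (absent k<σ′x)))
                        , (λ σ′x<k → trans (act-letter n σ D i k≤N) (cong (λ b → if b then d else u) (present σ′x<k)))
    where
    k : ℕ
    k = suc i
    x : ℕ
    x = τ (σ k)
    x-≥1 : 1 ≤ x
    x-≥1 = τ-≥1 (σ k) (to-≥1 k (s≤s z≤n) k≤N) (to-≤N k (s≤s z≤n) k≤N)
    x-≤N : x ≤ N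
    x-≤N = τ-≤N (σ k) (to-≥1 k (s≤s z≤n) k≤N) (to-≤N k (s≤s z≤n) k≤N)
    Q : ℕ → Bool
    Q = λ j → x ≡ᵇ σ j
    absent : k < σ′ x → any Q (range 1 k) ≡ false
    absent k<σ′x = trans (cong (any Q) (range≡interval 1 k)) (any-interval-false Q k 1 (λ j 1≤j j≤k →
      ≡ᵇ-false (λ x≡σj → <-irrefl refl (≤-<-trans (≤-pred j≤k)
        (subst (k <_) (trans (cong σ′ x≡σj) (inverseˡ j 1≤j (≤-trans (≤-pred j≤k) k≤N))) k<σ′x)))))
    present : σ′ x < k → any Q (range 1 k) ≡ true
    present σ′x<k = trans (cong (any Q) (range≡interval 1 k))
      (any-interval-true Q k 1 (σ′ x) (from-≥1 x x-≥1 x-≤N) (m≤n⇒m≤1+n σ′x<k)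
        (≡ᵇ-true (sym (inverseʳ x x-≥1 x-≤N))))

  private
    module W = MatchingWord n (conjugate τ τ-matching) (act n σ D) (act-length n σ D) letters

  act-dyck : IsDyck n (act n σ D)
  act-dyck = W.is-dyck

  act-tunnel : ∀ p → 1 ≤ p → p ≤ N → tunnel (act n σ D) p ≡ σ′ (τ (σ p))
  act-tunnel = W.tunnel≡matching

act-pointwise : ∀ n {σ₁ σ₂} D₁ D₂ →
  (∀ k → 1 ≤ k → k ≤ 2 * n → any (λ j → tunnel D₁ (σ₁ k) ≡ᵇ σ₁ j) (range 1 k)
                            ≡ any (λ j → tunnel D₂ (σ₂ k) ≡ᵇ σ₂ j) (range 1 k)) →
  act n σ₁ D₁ ≡ act n σ₂ D₂
act-pointwise n D₁ D₂ same =
  trans (cong (map _) (range≡interval 1 (2 * n)))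
        (trans (map-interval-cong _ _ (2 * n) 1 (λ k 1≤k k< → cong (λ b → if b then d else u) (same k 1≤k (≤-pred k<))))
               (sym (cong (map _) (range≡interval 1 (2 * n)))))

any-range-cong : ∀ k (Q Q′ : ℕ → Bool) → (∀ j → 1 ≤ j → j ≤ k → Q j ≡ Q′ j) →
                 any Q (range 1 k) ≡ any Q′ (range 1 k)
any-range-cong k Q Q′ eq = trans (cong (any Q) (range≡interval 1 k))
  (trans (any-interval-cong Q Q′ k 1 (λ j 1≤j j< → eq j 1≤j (≤-pred j<))) (sym (cong (any Q′) (range≡interval 1 k))))

act-cong : ∀ n {σ₁ σ₂} D → (∀ x → 1 ≤ x → x ≤ 2 * n → σ₁ x ≡ σ₂ x) → act n σ₁ D ≡ act n σ₂ D
act-cong n {σ₁} {σ₂} D σ₁≗σ₂ = act-pointwise n {σ₁} {σ₂} D D λ k 1≤k k≤N →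
  any-range-cong k _ _ λ j 1≤j j≤k →
    cong₂ (λ x y → tunnel D x ≡ᵇ y) (σ₁≗σ₂ k 1≤k k≤N) (σ₁≗σ₂ j 1≤j (≤-trans j≤k k≤N))

act-∘ : ∀ n {σ σ′ π π′} → ActsOnMatchings (2 * n) σ σ′ → ActsOnMatchings (2 * n) π π′ →
        act n (σ ∘ π) ≈[ n ] (act n π ∘ act n σ)
act-∘ n {σ} {σ′} {π} acts π-acts D dyck = act-pointwise n {σ ∘ π} {π} D (act n σ D) λ k 1≤k k≤N →
  any-range-cong k _ _ (λ j 1≤j j≤k → same-test k j 1≤k k≤N 1≤j (≤-trans j≤k k≤N))
  where
  open InversePair (ActsOnMatchings.inverse acts)
  module P = InversePair (ActsOnMatchings.inverse π-acts)
  open IsNoncrossingMatching (DyckPath.tunnel-matching n D dyck) using () renaming (≥1 to τ-≥1; ≤N to τ-≤N)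
  same-test : ∀ k j → 1 ≤ k → k ≤ 2 * n → 1 ≤ j → j ≤ 2 * n →
              (tunnel D (σ (π k)) ≡ᵇ σ (π j)) ≡ (tunnel (act n σ D) (π k) ≡ᵇ π j)
  same-test k j 1≤k k≤N 1≤j j≤N = begin
    (x ≡ᵇ σ y)                       ≡⟨ ≡ᵇ-cong (mk⇔ (λ x≡σy → trans (cong σ′ x≡σy) (inverseˡ y y-≥1 y-≤N))
                                                    (λ σ′x≡y → trans (sym (inverseʳ x x-≥1 x-≤N)) (cong σ σ′x≡y))) ⟩
    (σ′ x ≡ᵇ y)                      ≡⟨ cong (_≡ᵇ y) (Action.act-tunnel n acts D dyck (π k) πk-≥1 πk-≤N) ⟨
    (tunnel (act n σ D) (π k) ≡ᵇ y)  ∎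
    where
    open ≡-Reasoning
    y : ℕ
    y = π j
    y-≥1 : 1 ≤ y
    y-≥1 = P.to-≥1 j 1≤j j≤N
    y-≤N : y ≤ 2 * n
    y-≤N = P.to-≤N j 1≤j j≤N
    πk-≥1 : 1 ≤ π k
    πk-≥1 = P.to-≥1 k 1≤k k≤N
    πk-≤N : π k ≤ 2 * n
    πk-≤N = P.to-≤N k 1≤k k≤N
    x : ℕ
    x = tunnel D (σ (π k))
    x-≥1 : 1 ≤ x
    x-≥1 = τ-≥1 (σ (π k)) (to-≥1 (π k) πk-≥1 πk-≤N) (to-≤N (π k) πk-≥1 πk-≤N)
    x-≤N : x ≤ 2 * n
    x-≤N = τ-≤N (σ (π k)) (to-≥1 (π k) πk-≥1 πk-≤N) (to-≤N (π k) πk-≥1 πk-≤N)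

act-id : ∀ n D → IsDyck n D → act n id D ≡ D
act-id n D dyck = up-at-openers-unique (IsNoncrossingMatching.fixpoint-free (DyckPath.tunnel-matching n D dyck))
  (act n id D) D (act-length n id D) (proj₁ dyck) (Action.letters n (id-acts (2 * n)) D dyck) (DyckPath.up-at-openers n D dyck)

≈-∘ : ∀ {n f f′ g g′} → (∀ D → IsDyck n D → IsDyck n (g D)) →
      f ≈[ n ] f′ → g ≈[ n ] g′ → (f ∘ g) ≈[ n ] (f′ ∘ g′)
≈-∘ {f′ = f′} {g = g} g-dyck f≈f′ g≈g′ D dyck = trans (f≈f′ (g D) (g-dyck D dyck)) (cong f′ (g≈g′ D dyck))

^^-comm : ∀ (f : Word → Word) k W → (f ^^ k) (f W) ≡ f ((f ^^ k) W)
^^-comm f zero    W = refl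
^^-comm f (suc k) W = cong f (^^-comm f k W)

-- Rotations and reflections

conjugate-matching : ∀ {N σ σ′ M} → InversePair N σ σ′ → IsNoncrossingMatching N M →
  (∀ a b → 1 ≤ a → a < b → b ≤ N → b < σ′ (M (σ a)) → σ′ (M (σ a)) < σ′ (M (σ b)) → ⊥) →
  IsNoncrossingMatching N (σ′ ∘ M ∘ σ)
conjugate-matching {N} {σ} {σ′} {M} inv nc noncrossing′ = record
  { ≥1            = λ x 1≤x x≤N → from-≥1 (M (σ x)) (M-≥1 x 1≤x x≤N) (M-≤N x 1≤x x≤N)
  ; ≤N            = λ x 1≤x x≤N → from-≤N (M (σ x)) (M-≥1 x 1≤x x≤N) (M-≤N x 1≤x x≤N)
  ; involutive    = λ x 1≤x x≤N → begin
      σ′ (M (σ (σ′ (M (σ x)))))  ≡⟨ cong (σ′ ∘ M) (inverseʳ (M (σ x)) (M-≥1 x 1≤x x≤N) (M-≤N x 1≤x x≤N)) ⟩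
      σ′ (M (M (σ x)))           ≡⟨ cong σ′ (involutive (σ x) (to-≥1 x 1≤x x≤N) (to-≤N x 1≤x x≤N)) ⟩
      σ′ (σ x)                   ≡⟨ inverseˡ x 1≤x x≤N ⟩
      x                          ∎
  ; fixpoint-free = λ x 1≤x x≤N σ′Mσx≡x → fixpoint-free (σ x) (to-≥1 x 1≤x x≤N) (to-≤N x 1≤x x≤N)
      (trans (sym (inverseʳ (M (σ x)) (M-≥1 x 1≤x x≤N) (M-≤N x 1≤x x≤N))) (cong σ σ′Mσx≡x))
  ; noncrossing   = noncrossing′
  }
  where
  open InversePair inv
  open IsNoncrossingMatching nc
  open ≡-Reasoning
  M-≥1 : ∀ x → 1 ≤ x → x ≤ N → 1 ≤ M (σ x)
  M-≥1 x 1≤x x≤N = ≥1 (σ x) (to-≥1 x 1≤x x≤N) (to-≤N x 1≤x x≤N)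
  M-≤N : ∀ x → 1 ≤ x → x ≤ N → M (σ x) ≤ N
  M-≤N x 1≤x x≤N = ≤N (σ x) (to-≥1 x 1≤x x≤N) (to-≤N x 1≤x x≤N)

swap-inverse : ∀ {N σ σ′} → InversePair N σ σ′ → InversePair N σ′ σ
swap-inverse inv = record
  { to-≥1 = from-≥1 ; to-≤N = from-≤N ; from-≥1 = to-≥1 ; from-≤N = to-≤N
  ; inverseˡ = inverseʳ ; inverseʳ = inverseˡ }
  where open InversePair inv

reflect : ℕ → ℕ → ℕ
reflect N x = suc N ∸ x

module _ (N : ℕ) where

  reflect-inverse : InversePair N (reflect N) (reflect N)
  reflect-inverse = record
    { to-≥1 = ≥1 ; to-≤N = ≤N ; from-≥1 = ≥1 ; from-≤N = ≤N ; inverseˡ = involutive ; inverseʳ = involutive }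
    where
    ≥1 : ∀ x → 1 ≤ x → x ≤ N → 1 ≤ reflect N x
    ≥1 x _ x≤N = m<n⇒0<n∸m (s≤s x≤N)
    ≤N : ∀ x → 1 ≤ x → x ≤ N → reflect N x ≤ N
    ≤N x 1≤x _ = ∸-monoʳ-≤ (suc N) 1≤x
    involutive : ∀ x → 1 ≤ x → x ≤ N → reflect N (reflect N x) ≡ x
    involutive x _ x≤N = m∸[m∸n]≡n (m≤n⇒m≤1+n x≤N)

  reflect-flip : ∀ {x y} → y ≤ N → x < reflect N y → y < reflect N x
  reflect-flip {x} {y} y≤N x<Ry = m+n≤o⇒m≤o∸n (suc y)
    (subst (_≤ suc N) (cong suc (+-comm x y)) (m≤o∸n⇒m+n≤o (suc x) (m≤n⇒m≤1+n y≤N) x<Ry))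

  reflect-acts : ActsOnMatchings N (reflect N) (reflect N)
  reflect-acts = record
    { inverse   = reflect-inverse
    ; conjugate = λ M nc → conjugate-matching reflect-inverse nc (noncrossing′ M nc)
    }
    where
    open InversePair reflect-inverse
    noncrossing′ : ∀ M → IsNoncrossingMatching N M → ∀ a b → 1 ≤ a → a < b → b ≤ N →
                   b < reflect N (M (reflect N a)) → reflect N (M (reflect N a)) < reflect N (M (reflect N b)) → ⊥
    noncrossing′ M nc a b 1≤a a<b b≤N b<RX RX<RY =
      noncrossing Y X (≥1 B B-≥1 B-≤N) (∸-cancelʳ-< RX<RY) (≤N A A-≥1 A-≤N)
        (subst (X <_) (sym (involutive B B-≥1 B-≤N)) (reflect-flip (≤N A A-≥1 A-≤N) b<RX))
        (subst₂ _<_ (sym (involutive B B-≥1 B-≤N)) (sym (involutive A A-≥1 A-≤N)) (∸-monoʳ-< a<b (m≤n⇒m≤1+n b≤N)))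
      where
      open IsNoncrossingMatching nc
      a≤N : a ≤ N
      a≤N = ≤-trans (<⇒≤ a<b) b≤N
      1≤b : 1 ≤ b
      1≤b = ≤-trans 1≤a (<⇒≤ a<b)
      A : ℕ
      A = reflect N a
      B : ℕ
      B = reflect N b
      A-≥1 : 1 ≤ A
      A-≥1 = to-≥1 a 1≤a a≤N
      A-≤N : A ≤ N
      A-≤N = to-≤N a 1≤a a≤N
      B-≥1 : 1 ≤ B
      B-≥1 = to-≥1 b 1≤b b≤N
      B-≤N : B ≤ N
      B-≤N = to-≤N b 1≤b b≤N
      X : ℕ
      X = M A
      Y : ℕ
      Y = M B

module Dihedral (n : ℕ) (1≤n : 1 ≤ n) where

  private
    N : ℕ
    N = 2 * n

  2≤N : 2 ≤ N
  2≤N = *-monoʳ-≤ 2 1≤n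

  1≤N : 1 ≤ N
  1≤N = ≤-trans (s≤s z≤n) 2≤N

  ρ-< : ∀ {x} → x < N → ρ n x ≡ suc x
  ρ-< {x} x<N = cong (λ b → if b then suc x else 1) (<ᵇ-true x<N)

  ρ-N : ρ n N ≡ 1
  ρ-N = cong (λ b → if b then suc N else 1) (<ᵇ-false {N} ≤-refl)

  ω-< : ∀ {x} → x < N → ω n x ≡ N ∸ x
  ω-< {x} x<N = cong (λ b → if b then N ∸ x else N) (<ᵇ-true x<N)

  ω-N : ω n N ≡ N
  ω-N = cong (λ b → if b then N ∸ N else N) (<ᵇ-false {N} ≤-refl)

  ρ-inverse : InversePair N (ρ n) (ρ⁻¹ n)
  ρ-inverse = record
    { to-≥1 = to-≥1 ; to-≤N = to-≤N ; from-≥1 = from-≥1 ; from-≤N = from-≤N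
    ; inverseˡ = inverseˡ ; inverseʳ = inverseʳ }
    where
    to-≥1 : ∀ x → 1 ≤ x → x ≤ N → 1 ≤ ρ n x
    to-≥1 x _ x≤N with m≤n⇒m<n∨m≡n x≤N
    ... | inj₁ x<N  = subst (1 ≤_) (sym (ρ-< x<N)) (s≤s z≤n)
    ... | inj₂ refl = subst (1 ≤_) (sym ρ-N) ≤-refl
    to-≤N : ∀ x → 1 ≤ x → x ≤ N → ρ n x ≤ N
    to-≤N x _ x≤N with m≤n⇒m<n∨m≡n x≤N
    ... | inj₁ x<N  = subst (_≤ N) (sym (ρ-< x<N)) x<N
    ... | inj₂ refl = subst (_≤ N) (sym ρ-N) 1≤N
    from-≥1 : ∀ x → 1 ≤ x → x ≤ N → 1 ≤ ρ⁻¹ n x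
    from-≥1 (suc zero)    _ _ = 1≤N
    from-≥1 (suc (suc x)) _ _ = s≤s z≤n
    from-≤N : ∀ x → 1 ≤ x → x ≤ N → ρ⁻¹ n x ≤ N
    from-≤N (suc zero)    _ _   = ≤-refl
    from-≤N (suc (suc x)) _ x≤N = ≤-trans (n≤1+n (suc x)) x≤N
    inverseˡ : ∀ x → 1 ≤ x → x ≤ N → ρ⁻¹ n (ρ n x) ≡ x
    inverseˡ (suc x) _ x≤N with m≤n⇒m<n∨m≡n x≤N
    ... | inj₁ x<N  = cong (ρ⁻¹ n) (ρ-< x<N)
    ... | inj₂ x≡N  = trans (cong (ρ⁻¹ n ∘ ρ n) x≡N) (trans (cong (ρ⁻¹ n) ρ-N) (sym x≡N))
    inverseʳ : ∀ x → 1 ≤ x → x ≤ N → ρ n (ρ⁻¹ n x) ≡ x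
    inverseʳ (suc zero)    _ _   = ρ-N
    inverseʳ (suc (suc x)) _ x≤N = ρ-< x≤N

  ω-inverse : InversePair N (ω n) (ω n)
  ω-inverse = record
    { to-≥1 = ≥1 ; to-≤N = ≤N ; from-≥1 = ≥1 ; from-≤N = ≤N ; inverseˡ = involutive ; inverseʳ = involutive }
    where
    ≥1 : ∀ x → 1 ≤ x → x ≤ N → 1 ≤ ω n x
    ≥1 x _ x≤N with m≤n⇒m<n∨m≡n x≤N
    ... | inj₁ x<N  = subst (1 ≤_) (sym (ω-< x<N)) (m<n⇒0<n∸m x<N)
    ... | inj₂ refl = subst (1 ≤_) (sym ω-N) 1≤N
    ≤N : ∀ x → 1 ≤ x → x ≤ N → ω n x ≤ N
    ≤N x _ x≤N with m≤n⇒m<n∨m≡n x≤N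
    ... | inj₁ x<N  = subst (_≤ N) (sym (ω-< x<N)) (m∸n≤m N x)
    ... | inj₂ refl = subst (_≤ N) (sym ω-N) ≤-refl
    involutive : ∀ x → 1 ≤ x → x ≤ N → ω n (ω n x) ≡ x
    involutive x 1≤x x≤N with m≤n⇒m<n∨m≡n x≤N
    ... | inj₁ x<N  = trans (cong (ω n) (ω-< x<N)) (trans (ω-< (∸-monoʳ-< {N} {x} {0} 1≤x x≤N)) (m∸[m∸n]≡n x≤N))
    ... | inj₂ refl = trans (cong (ω n) ω-N) ω-N

  ρ-acts : ActsOnMatchings N (ρ n) (ρ⁻¹ n)
  ρ-acts = record { inverse = ρ-inverse ; conjugate = λ M nc → conjugate-matching ρ-inverse nc (noncrossing′ M nc) }
    where
    open InversePair ρ-inverse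
    noncrossing′ : ∀ M → IsNoncrossingMatching N M → ∀ a b → 1 ≤ a → a < b → b ≤ N →
                   b < ρ⁻¹ n (M (ρ n a)) → ρ⁻¹ n (M (ρ n a)) < ρ⁻¹ n (M (ρ n b)) → ⊥
    noncrossing′ M nc a b 1≤a a<b b≤N b<M′a M′a<M′b = crossing (M (suc a)) (M (suc b)) refl refl
      (subst (λ z → b < ρ⁻¹ n (M z)) ρa≡ b<M′a) (subst₂ (λ z w → ρ⁻¹ n (M z) < ρ⁻¹ n (M w)) ρa≡ ρb≡ M′a<M′b)
      where
      open IsNoncrossingMatching nc
      1≤b : 1 ≤ b
      1≤b = ≤-trans 1≤a (<⇒≤ a<b)
      M′b≤N : ρ⁻¹ n (M (ρ n b)) ≤ N
      M′b≤N = from-≤N (M (ρ n b)) (≥1 (ρ n b) (to-≥1 b 1≤b b≤N) (to-≤N b 1≤b b≤N))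
                                  (≤N (ρ n b) (to-≥1 b 1≤b b≤N) (to-≤N b 1≤b b≤N))
      b<N : b < N
      b<N = <-≤-trans b<M′a (≤-trans (<⇒≤ M′a<M′b) M′b≤N)
      a<N : a < N
      a<N = <-trans a<b b<N
      ρa≡ : ρ n a ≡ suc a
      ρa≡ = ρ-< a<N
      ρb≡ : ρ n b ≡ suc b
      ρb≡ = ρ-< b<N
      M-≥1 : ∀ x → x < N → 1 ≤ M (suc x)
      M-≥1 x x<N = ≥1 (suc x) (s≤s z≤n) x<N
      crossing : ∀ A B → M (suc a) ≡ A → M (suc b) ≡ B → b < ρ⁻¹ n A → ρ⁻¹ n A < ρ⁻¹ n B → ⊥
      crossing zero _ A≡ _ _ _ = <⇒≱ (M-≥1 a a<N) (≤-reflexive A≡)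
      crossing (suc zero) B _ B≡ _ N<ρ⁻¹B = <⇒≱ N<ρ⁻¹B
        (subst (λ z → ρ⁻¹ n z ≤ N) B≡ (from-≤N (M (suc b)) (M-≥1 b b<N) (≤N (suc b) (s≤s z≤n) b<N)))
      crossing (suc (suc A′)) zero _ B≡ _ _ = <⇒≱ (M-≥1 b b<N) (≤-reflexive B≡)
      crossing (suc (suc A′)) (suc zero) A≡ B≡ b<A′ _ =
        noncrossing 1 (suc a) (s≤s z≤n) (s≤s 1≤a) a<N (subst (suc a <_) (sym M1≡) (s≤s a<b))
          (subst₂ _<_ (sym M1≡) (sym A≡) (s≤s b<A′))
        where
        M1≡ : M 1 ≡ suc b
        M1≡ = trans (cong M (sym B≡)) (involutive (suc b) (s≤s z≤n) b<N)
      crossing (suc (suc A′)) (suc (suc B′)) A≡ B≡ b<A′ A′<B′ =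
        noncrossing (suc a) (suc b) (s≤s z≤n) (s≤s a<b) b<N (subst (suc b <_) (sym A≡) (s≤s b<A′))
          (subst₂ _<_ (sym A≡) (sym B≡) (s≤s A′<B′))

  rotate : ℕ → ℕ → ℕ
  rotate zero    = id
  rotate (suc k) = rotate k ∘ ρ n

  unrotate : ℕ → ℕ → ℕ
  unrotate zero    = id
  unrotate (suc k) = ρ⁻¹ n ∘ unrotate k

  rotate-acts : ∀ k → ActsOnMatchings N (rotate k) (unrotate k)
  rotate-acts zero    = id-acts N
  rotate-acts (suc k) = ∘-acts (rotate-acts k) ρ-acts

  rotate-+ : ∀ a b x → rotate (a + b) x ≡ rotate b (rotate a x)
  rotate-+ zero    b x = refl
  rotate-+ (suc a) b x = rotate-+ a b (ρ n x)

  rotate-within : ∀ k x → x + k ≤ N → rotate k x ≡ x + k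
  rotate-within zero    x _   = sym (+-identityʳ x)
  rotate-within (suc k) x x+k≤N = begin
    rotate k (ρ n x)  ≡⟨ cong (rotate k) (ρ-< (<-≤-trans (m<m+n x (s≤s z≤n)) x+k≤N)) ⟩
    rotate k (suc x)  ≡⟨ rotate-within k (suc x) (subst (_≤ N) (+-suc x k) x+k≤N) ⟩
    suc x + k         ≡⟨ +-suc x k ⟨
    x + suc k         ∎
    where open ≡-Reasoning

  rotate-full-turn : ∀ x → 1 ≤ x → x ≤ N → rotate N x ≡ x
  rotate-full-turn x 1≤x x≤N = begin
    rotate N x                               ≡⟨ cong (λ k → rotate k x) (sym N≡) ⟩
    rotate ((N ∸ x) + (1 + (x ∸ 1))) x      ≡⟨ rotate-+ (N ∸ x) (1 + (x ∸ 1)) x ⟩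
    rotate (x ∸ 1) (ρ n (rotate (N ∸ x) x)) ≡⟨ cong (rotate (x ∸ 1) ∘ ρ n)
                                                  (trans (rotate-within (N ∸ x) x (≤-reflexive x+N-x≡N)) x+N-x≡N) ⟩
    rotate (x ∸ 1) (ρ n N)                   ≡⟨ cong (rotate (x ∸ 1)) ρ-N ⟩
    rotate (x ∸ 1) 1                         ≡⟨ rotate-within (x ∸ 1) 1 (subst (_≤ N) (sym (m+[n∸m]≡n 1≤x)) x≤N) ⟩
    1 + (x ∸ 1)                              ≡⟨ m+[n∸m]≡n 1≤x ⟩
    x                                        ∎
    where
    open ≡-Reasoning
    x+N-x≡N : x + (N ∸ x) ≡ N
    x+N-x≡N = m+[n∸m]≡n x≤N
    N≡ : (N ∸ x) + (1 + (x ∸ 1)) ≡ N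
    N≡ = trans (cong ((N ∸ x) +_) (m+[n∸m]≡n 1≤x)) (m∸n+n≡m x≤N)

  ρ⁻¹≗rotate : ∀ x → 1 ≤ x → x ≤ N → ρ⁻¹ n x ≡ rotate (N ∸ 1) x
  ρ⁻¹≗rotate x 1≤x x≤N = begin
    ρ⁻¹ n x                             ≡⟨ rotate-full-turn (ρ⁻¹ n x) (from-≥1 x 1≤x x≤N) (from-≤N x 1≤x x≤N) ⟨
    rotate N (ρ⁻¹ n x)                  ≡⟨ cong (λ k → rotate k (ρ⁻¹ n x)) (sym (m+[n∸m]≡n 1≤N)) ⟩
    rotate (N ∸ 1) (ρ n (ρ⁻¹ n x))      ≡⟨ cong (rotate (N ∸ 1)) (inverseʳ x 1≤x x≤N) ⟩
    rotate (N ∸ 1) x                    ∎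
    where
    open ≡-Reasoning
    open InversePair ρ-inverse

  ρ⁻¹-acts : ActsOnMatchings N (ρ⁻¹ n) (ρ n)
  ρ⁻¹-acts = acts-cong (rotate-acts (N ∸ 1)) ρ⁻¹≗rotate (swap-inverse ρ-inverse)

  ω≗ρ⁻¹∘reflect : ∀ x → 1 ≤ x → x ≤ N → ω n x ≡ ρ⁻¹ n (reflect N x)
  ω≗ρ⁻¹∘reflect x 1≤x x≤N with m≤n⇒m<n∨m≡n x≤N
  ... | inj₂ refl = trans ω-N (cong (ρ⁻¹ n) (sym (m+n∸n≡m 1 N)))
  ... | inj₁ x<N  =
    trans (ω-< x<N) (sym (trans (cong (ρ⁻¹ n) (+-∸-assoc 1 x≤N)) (ρ⁻¹-suc (N ∸ x) (m<n⇒0<n∸m x<N))))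
    where
    ρ⁻¹-suc : ∀ m → 1 ≤ m → ρ⁻¹ n (suc m) ≡ m
    ρ⁻¹-suc (suc m) _ = refl

  ω-acts : ActsOnMatchings N (ω n) (ω n)
  ω-acts = acts-cong (∘-acts ρ⁻¹-acts (reflect-acts N)) ω≗ρ⁻¹∘reflect ω-inverse


  ρωρ≗ω : ∀ x → 1 ≤ x → x ≤ N → ρ n (ω n (ρ n x)) ≡ ω n x
  ρωρ≗ω x 1≤x x≤N with m≤n⇒m<n∨m≡n x≤N
  ... | inj₂ refl = begin
      ρ n (ω n (ρ n N))  ≡⟨ cong (ρ n ∘ ω n) ρ-N ⟩
      ρ n (ω n 1)        ≡⟨ cong (ρ n) (ω-< 2≤N) ⟩
      ρ n (N ∸ 1)        ≡⟨ ρ-< (∸-monoʳ-< {N} {1} {0} (s≤s z≤n) 1≤N) ⟩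
      suc (N ∸ 1)        ≡⟨ m+[n∸m]≡n 1≤N ⟩
      N                  ≡⟨ ω-N ⟨
      ω n N              ∎
    where open ≡-Reasoning
  ... | inj₁ x<N with m≤n⇒m<n∨m≡n x<N
  ...   | inj₁ sx<N = begin
      ρ n (ω n (ρ n x))  ≡⟨ cong (ρ n ∘ ω n) (ρ-< x<N) ⟩
      ρ n (ω n (suc x))  ≡⟨ cong (ρ n) (ω-< sx<N) ⟩
      ρ n (N ∸ suc x)    ≡⟨ ρ-< (∸-monoʳ-< {N} {suc x} {0} (s≤s z≤n) (<⇒≤ sx<N)) ⟩
      suc (N ∸ suc x)    ≡⟨ +-∸-assoc 1 x<N ⟨
      N ∸ x              ≡⟨ ω-< x<N ⟨
      ω n x              ∎
    where open ≡-Reasoning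
  ...   | inj₂ sx≡N = begin
      ρ n (ω n (ρ n x))  ≡⟨ cong (ρ n ∘ ω n) (trans (ρ-< x<N) sx≡N) ⟩
      ρ n (ω n N)        ≡⟨ cong (ρ n) ω-N ⟩
      ρ n N              ≡⟨ ρ-N ⟩
      1                  ≡⟨ m+n∸n≡m 1 x ⟨
      suc x ∸ x          ≡⟨ cong (_∸ x) sx≡N ⟩
      N ∸ x              ≡⟨ ω-< x<N ⟨
      ω n x              ∎
    where open ≡-Reasoning

  G-acts : ∀ {g} → InG n g → Σ (ℕ → ℕ) (ActsOnMatchings N g)
  G-acts G-id      = id , id-acts N
  G-acts G-ρ       = ρ⁻¹ n , ρ-acts
  G-acts G-ρ⁻¹     = ρ n , ρ⁻¹-acts
  G-acts G-ω       = ω n , ω-acts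
  G-acts (G-∘ p q) = _ , ∘-acts (proj₂ (G-acts p)) (proj₂ (G-acts q))

  G-preserves-Dyck : ∀ {g} → InG n g → ∀ D → IsDyck n D → IsDyck n (act n g D)
  G-preserves-Dyck p = Action.act-dyck n (proj₂ (G-acts p))

  act-ρ^ : ∀ k → (act n (ρ n) ^^ k) ≈[ n ] act n (rotate k)
  act-ρ^ zero    D dyck = sym (act-id n D dyck)
  act-ρ^ (suc k) D dyck = trans (cong (act n (ρ n)) (act-ρ^ k D dyck)) (sym (act-∘ n (rotate-acts k) ρ-acts D dyck))

  act-ρ⁻¹ : act n (ρ⁻¹ n) ≈[ n ] (act n (ρ n) ^^ (N ∸ 1))
  act-ρ⁻¹ D dyck = trans (act-cong n D ρ⁻¹≗rotate) (sym (act-ρ^ (N ∸ 1) D dyck))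

  ρ^N≈id : (act n (ρ n) ^^ N) ≈[ n ] id
  ρ^N≈id D dyck = trans (act-ρ^ N D dyck) (trans (act-cong n D rotate-full-turn) (act-id n D dyck))

  ω∘ω≈id : (act n (ω n) ∘ act n (ω n)) ≈[ n ] id
  ω∘ω≈id D dyck =
    trans (sym (act-∘ n ω-acts ω-acts D dyck)) (trans (act-cong n D (InversePair.inverseˡ ω-inverse)) (act-id n D dyck))

  ρωρ≈ω : (act n (ρ n) ∘ act n (ω n) ∘ act n (ρ n)) ≈[ n ] act n (ω n)
  ρωρ≈ω D dyck = begin
    act n (ρ n) (act n (ω n) (act n (ρ n) D))  ≡⟨ cong (act n (ρ n)) (act-∘ n ρ-acts ω-acts D dyck) ⟨
    act n (ρ n) (act n (ρ n ∘ ω n) D)          ≡⟨ act-∘ n (∘-acts ρ-acts ω-acts) ρ-acts D dyck ⟨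
    act n (ρ n ∘ ω n ∘ ρ n) D                  ≡⟨ act-cong n D ρωρ≗ω ⟩
    act n (ω n) D                              ∎
    where open ≡-Reasoning

  ^^-InM : ∀ k → InM n (act n (ρ n) ^^ k)
  ^^-InM zero    = M-id
  ^^-InM (suc k) = M-∘ M-ρ (^^-InM k)

  InG⇒InM : ∀ g → InG n g → Σ (Word → Word) λ f → InM n f × (act n g ≈[ n ] f)
  InG⇒InM _ G-id  = id , M-id , act-id n
  InG⇒InM _ G-ρ   = act n (ρ n) , M-ρ , λ _ _ → refl
  InG⇒InM _ G-ρ⁻¹ = act n (ρ n) ^^ (N ∸ 1) , ^^-InM (N ∸ 1) , act-ρ⁻¹
  InG⇒InM _ G-ω   = act n (ω n) , M-ω , λ _ _ → refl
  InG⇒InM _ (G-∘ p q) with InG⇒InM _ p | InG⇒InM _ q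
  ... | F , F∈M , f≈F | G , G∈M , g≈G =
    G ∘ F , M-∘ G∈M F∈M , λ D dyck → trans (act-∘ n (proj₂ (G-acts p)) (proj₂ (G-acts q)) D dyck)
                                           (≈-∘ (G-preserves-Dyck p) g≈G f≈F D dyck)

  InM⇒InG : ∀ f → InM n f → Σ (ℕ → ℕ) λ g → InG n g × (act n g ≈[ n ] f)
  InM⇒InG _ M-id = id , G-id , act-id n
  InM⇒InG _ M-ρ  = ρ n , G-ρ , λ _ _ → refl
  InM⇒InG _ M-ω  = ω n , G-ω , λ _ _ → refl
  InM⇒InG _ (M-∘ p q) with InM⇒InG _ p | InM⇒InG _ q
  ... | g₁ , g₁∈G , g₁≈f₁ | g₂ , g₂∈G , g₂≈f₂ =
    g₂ ∘ g₁ , G-∘ g₂∈G g₁∈G , λ D dyck → trans (act-∘ n (proj₂ (G-acts g₂∈G)) (proj₂ (G-acts g₁∈G)) D dyck)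
                                               (≈-∘ (G-preserves-Dyck g₂∈G) g₁≈f₁ g₂≈f₂ D dyck)

  InM-preserves-Dyck : ∀ f → InM n f → ∀ D → IsDyck n D → IsDyck n (f D)
  InM-preserves-Dyck _ M-id      _ dyck = dyck
  InM-preserves-Dyck _ M-ρ       = G-preserves-Dyck G-ρ
  InM-preserves-Dyck _ M-ω       = G-preserves-Dyck G-ω
  InM-preserves-Dyck _ (M-∘ p q) D dyck = InM-preserves-Dyck _ p _ (InM-preserves-Dyck _ q D dyck)

  InM-invertible : ∀ f → InM n f →
                   Σ (Word → Word) λ f′ → InM n f′ × ((f ∘ f′) ≈[ n ] id) × ((f′ ∘ f) ≈[ n ] id)
  InM-invertible _ M-id = id , M-id , (λ _ _ → refl) , (λ _ _ → refl)
  InM-invertible _ M-ρ  = act n (ρ n) ^^ (N ∸ 1) , ^^-InM (N ∸ 1) , ρ^N≈id′ ,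
                          λ D dyck → trans (^^-comm (act n (ρ n)) (N ∸ 1) D) (ρ^N≈id′ D dyck)
    where
    ρ^N≈id′ : (act n (ρ n) ^^ suc (N ∸ 1)) ≈[ n ] id
    ρ^N≈id′ = subst (λ k → (act n (ρ n) ^^ k) ≈[ n ] id) (sym (m+[n∸m]≡n 1≤N)) ρ^N≈id
  InM-invertible _ M-ω  = act n (ω n) , M-ω , ω∘ω≈id , ω∘ω≈id
  InM-invertible _ (M-∘ {f} {g} p q) with InM-invertible _ p | InM-invertible _ q
  ... | f′ , f′∈M , f∘f′≈id , f′∘f≈id | g′ , g′∈M , g∘g′≈id , g′∘g≈id =
    g′ ∘ f′ , M-∘ g′∈M f′∈M ,
    (λ D dyck → trans (cong f (g∘g′≈id (f′ D) (InM-preserves-Dyck _ f′∈M D dyck))) (f∘f′≈id D dyck)) ,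
    (λ D dyck → trans (cong g′ (f′∘f≈id (g D) (InM-preserves-Dyck _ q D dyck))) (g′∘g≈id D dyck))

corollary1 : (n : ℕ) → 1 ≤ n →
    ((∀ g → InG n g → Σ (Word → Word) λ f → InM n f × (act n g ≈[ n ] f))
     × (∀ f → InM n f → Σ (ℕ → ℕ) λ g → InG n g × (act n g ≈[ n ] f)))
    × (∀ f → InM n f →
         (∀ D → IsDyck n D → IsDyck n (f D))
         × Σ (Word → Word) λ f′ → InM n f′
             × ((f ∘ f′) ≈[ n ] id) × ((f′ ∘ f) ≈[ n ] id))
    × ((act n (ρ n) ^^ (2 * n)) ≈[ n ] id)
    × ((act n (ω n) ∘ act n (ω n)) ≈[ n ] id)
    × ((act n (ρ n) ∘ act n (ω n) ∘ act n (ρ n)) ≈[ n ] act n (ω n))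
corollary1 n 1≤n =
  (InG⇒InM , InM⇒InG) ,
  (λ f f∈M → InM-preserves-Dyck f f∈M , InM-invertible f f∈M) ,
  ρ^N≈id , ω∘ω≈id , ρωρ≈ω
  where open Dihedral n 1≤n
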